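{- Let $f\in\mathrm{QSym}$ and let $m$ be a positive integer. Then \[ h_m\prec f=\sum_{\alpha\in\mathrm{Comp}}(-1)^{|\alpha|}F_{\alpha\odot(m)}\,R_{\omega(\alpha)}^{\perp}f, \] where the sum has only finitely many nonzero terms.
   Context: Let $\mathbf{k}$ be a commutative ring and $\mathbf{k}[[x_1,x_2,\ldots]]$ the ring of formal power series in commuting indeterminates, with the product topology (a sequence converges iff each monomial coefficient eventually stabilizes). A monomial is $x_1^{a_1}x_2^{a_2}\cdots$ with finitely many nonzero exponents; $\mathrm{Supp}\,\mathfrak m=\{i: a_i>0\}$; we set $\min\varnothing=\infty$ (greater than every integer). The binary operation $\prec$ on $\mathbf{k}[[x_1,x_2,\ldots]]$ is the unique $\mathbf{k}$-bilinear continuous operation with $\mathfrak m\prec\mathfrak n=\mathfrak m\mathfrak n$ if $\min(\mathrm{Supp}\,\mathfrak m)<\min(\mathrm{Supp}\,\mathfrak n)$ and $\mathfrak m\prec\mathfrak n=0$ otherwise, for monomials $\mathfrak m,\mathfrak n$. A composition is a finite sequence of positive integers; $\mathrm{Comp}$ is the set of compositions, $|\alpha|$ the sum of entries. $\mathrm{QSym}$ is the Hopf algebra of quasisymmetric functions over $\mathbf{k}$ (basis $M_\alpha=\sum_{1\le i_1<\cdots<i_\ell}x_{i_1}^{\alpha_1}\cdots x_{i_\ell}^{\alpha_\ell}$, $\Delta(M_\alpha)=\sum_{i=0}^\ell M_{(\alpha_1,\ldots,\alpha_i)}\otimes M_{(\alpha_{i+1},\ldots,\alpha_\ell)}$). For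 a composition $\alpha$ of $n$ with $\ell$ parts, $D(\alpha)=\{\alpha_1,\alpha_1+\alpha_2,\ldots,\alpha_1+\cdots+\alpha_{\ell-1}\}$ and $F_\alpha=\sum x_{i_1}\cdots x_{i_n}$ over $i_1\le\cdots\le i_n$ with $i_j<i_{j+1}$ for $j\in D(\alpha)$. $h_m=\sum_{i_1\le i_2\le\cdots\le i_m}x_{i_1}\cdots x_{i_m}$. $\mathrm{NSym}$ is the Hopf algebra of noncommutative symmetric functions, with a nondegenerate Hopf pairing $(\cdot,\cdot):\mathrm{NSym}\times\mathrm{QSym}\to\mathbf{k}$; $(R_\alpha)_{\alpha\in\mathrm{Comp}}$ is the ribbon basis of $\mathrm{NSym}$, dual to $(F_\alpha)$. For $g\in\mathrm{NSym}$, $g^\perp:\mathrm{QSym}\to\mathrm{QSym}$ is the adjoint of left multiplication by $g$: $(a,g^\perp c)=(ga,c)$; equivalently $g^\perp f=\sum_{(f)}(g,f_{(1)})f_{(2)}$. For compositions $\alpha,\beta$: $\alpha\odot\beta=\beta$ if $\alpha$ is empty, $=\alpha$ if $\beta$ is empty, and otherwise $(\alpha_1,\ldots,\alpha_{\ell-1},\alpha_\ell+\beta_1,\beta_2,\ldots,\beta_m)$. For a composition $\alpha$ of $n$, $\mathrm{rev}\,\alpha$ is $\alpha$ reversed and $\omega(\alpha)$ is the unique composition $\beta$ of $n$ with $D(\beta)=\{1,\ldots,n-1\}\setminus D(\mathrm{rev}\,\alpha)$. -}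

module Defs where

open import Level using (Level)
open import Algebra.Bundles using (CommutativeRing)
open import Data.Bool using (Bool; true; false; not; _∧_; if_then_else_)
open import Data.Nat using (ℕ; zero; suc; _∸_; _<ᵇ_; _≡ᵇ_; _≤_)
open import Data.Nat.ListAction using (sum)
open import Data.Bool.ListAction using (and)
open import Data.List using (List; []; _∷_; _++_; map; concatMap; concat; foldr; upTo;
  replicate; length; reverse; zip; take; drop)
open import Data.List.Properties using (≡-dec)
open import Data.Maybe using (Maybe; just; nothing)
open import Data.Product using (_×_; _,_; ∃-syntax)
open import Relation.Nullary using (does)
import Data.Nat as N

-- A composition is encoded as a list of naturals, entry k standing for
-- the positive part (suc k).  So (2,1,3) is encoded as 1 ∷ 0 ∷ 2 ∷ [].
Comp : Set
Comp = List ℕ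

parts : Comp → List ℕ
parts = map suc

size : Comp → ℕ
size α = sum (parts α)

_==_ : Comp → Comp → Bool
α == β = does (≡-dec N._≟_ α β)

-- Descent set D(α) of a composition α of n, as the list of booleans
-- b_1 … b_{n-1} with b_j = true iff j ∈ D(α).
-- (a part of size k+1 contributes k falses; parts are separated by true)
toBools : Comp → List Bool
toBools []           = []
toBools (a ∷ [])     = replicate a false
toBools (a ∷ b ∷ α)  = replicate a false ++ (true ∷ toBools (b ∷ α))

fromBoolsAux : ℕ → List Bool → Comp
fromBoolsAux k []            = k ∷ []
fromBoolsAux k (false ∷ bs)  = fromBoolsAux (suc k) bs
fromBoolsAux k (true ∷ bs)   = k ∷ fromBoolsAux 0 bs

fromBools : List Bool → Comp
fromBools = fromBoolsAux 0

rev : Comp → Comp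
rev = reverse

ω : Comp → Comp
ω []      = []
ω (a ∷ α) = fromBools (map not (toBools (rev (a ∷ α))))

_⊙_ : Comp → Comp → Comp
[]           ⊙ β       = β
(a ∷ [])     ⊙ []      = a ∷ []
(a ∷ [])     ⊙ (b ∷ β) = (a N.+ b N.+ 1) ∷ β
(a ∷ a' ∷ α) ⊙ β       = a ∷ ((a' ∷ α) ⊙ β)

-- The one-part composition (m), for m ≥ 1.
single : ℕ → Comp
single m = (m ∸ 1) ∷ []

allBools : ℕ → List (List Bool)
allBools zero    = [] ∷ []
allBools (suc k) = concatMap (λ bs → (false ∷ bs) ∷ (true ∷ bs) ∷ []) (allBools k)

compsOf : ℕ → List Comp
compsOf zero    = [] ∷ []
compsOf (suc n) = map fromBools (allBools n)

compsBelow : ℕ → List Comp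
compsBelow N = concatMap compsOf (upTo N)

-- A monomial x_1^{e_1} x_2^{e_2} ⋯ is encoded by its exponent list
-- e_1 ∷ e_2 ∷ … (trailing zeros allowed; all series below depend only
-- on the monomial, not on trailing zeros).
Mono : Set
Mono = List ℕ

degree : Mono → ℕ
degree = sum

-- min Supp as Maybe (nothing = ∞), 1-based indices
minSuppFrom : ℕ → Mono → Maybe ℕ
minSuppFrom i []            = nothing
minSuppFrom i (zero ∷ p)    = minSuppFrom (suc i) p
minSuppFrom i (suc e ∷ p)   = just i

minSupp : Mono → Maybe ℕ
minSupp = minSuppFrom 1

minLt : Mono → Mono → Bool
minLt m n with minSupp m | minSupp n
... | nothing | _       = false
... | just i  | nothing = true
... | just i  | just j  = i <ᵇ j

splits : Mono → List (Mono × Mono)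
splits []      = ([] , []) ∷ []
splits (e ∷ p) = concatMap (λ k → map (λ { (d , r) → (k ∷ d , (e ∸ k) ∷ r) }) (splits p))
                           (upTo (suc e))

flat : Mono → Comp
flat []          = []
flat (zero ∷ p)  = flat p
flat (suc e ∷ p) = e ∷ flat p

-- the weakly increasing index sequence i_1 ≤ ⋯ ≤ i_n with
-- x_{i_1}⋯x_{i_n} = p
seqFrom : ℕ → Mono → List ℕ
seqFrom i []      = []
seqFrom i (e ∷ p) = replicate e i ++ seqFrom (suc i) p

indexSeq : Mono → List ℕ
indexSeq = seqFrom 1

consecutive : List ℕ → List (ℕ × ℕ)
consecutive []       = []
consecutive (x ∷ xs) = zip (x ∷ xs) xs

-- does the sequence i_1 ≤ ⋯ ≤ i_n satisfy i_j < i_{j+1} for j ∈ D(α),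
-- with n = |α| ?
FCond : Comp → Mono → Bool
FCond α p =
  (length (indexSeq p) ≡ᵇ size α) ∧
  and (map (λ { (b , (s , t)) → if b then s <ᵇ t else true })
           (zip (toBools α) (consecutive (indexSeq p))))

module _ {c ℓ : Level} (R : CommutativeRing c ℓ) where
  open CommutativeRing R

  -- formal power series in x_1, x_2, … : coefficient functions
  PS : Set c
  PS = Mono → Carrier

  Σ : {a : Level} {A : Set a} → List A → (A → Carrier) → Carrier
  Σ xs g = foldr (λ x acc → g x + acc) 0# xs

  δ : Bool → Carrier
  δ b = if b then 1# else 0#

  sgn : ℕ → Carrier
  sgn zero    = 1#
  sgn (suc n) = - sgn n

  mulPS : PS → PS → PS
  mulPS f g p = Σ (splits p) (λ { (d , e) → f d * g e })

  -- the operation ≺ (bilinear continuous extension of the monomial rule)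
  precPS : PS → PS → PS
  precPS f g p = Σ (splits p) (λ { (d , e) → δ (minLt d e) * f d * g e })

  hPS : ℕ → PS
  hPS m p = δ (degree p ≡ᵇ m)

  FPS : Comp → PS
  FPS α p = δ (FCond α p)

  MPS : Comp → PS
  MPS α p = δ (flat p == α)

  -- elements of QSym, as finite k-linear combinations of the M_α
  QS : Set c
  QS = List (Carrier × Comp)

  ⟦_⟧ : QS → PS
  ⟦ f ⟧ p = Σ f (λ { (a , α) → a * MPS α p })

  scale : Carrier → QS → QS
  scale a = map (λ { (b , α) → (a * b , α) })

  -- a linear functional on QSym, given on representatives
  -- The functional g ↦ (R_β , g): k-linear on QSym and dual to the
  -- fundamental basis, (R_β , F_α) = [α = β].  (These conditions
  -- determine it uniquely, since (F_α) is a basis of QSym.)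
  record RibbonPairing : Set (c Level.⊔ ℓ) where
    field
      pair      : Comp → QS → Carrier
      pair-resp : ∀ β f g → (∀ p → ⟦ f ⟧ p ≈ ⟦ g ⟧ p) → pair β f ≈ pair β g
      pair-++   : ∀ β f g → pair β (f ++ g) ≈ pair β f + pair β g
      pair-scal : ∀ β a f → pair β (scale a f) ≈ a * pair β f
      pair-F    : ∀ β α g → (∀ p → ⟦ g ⟧ p ≈ FPS α p) → pair β g ≈ δ (α == β)

  module _ (P : RibbonPairing) where
    open RibbonPairing P

    -- Δ(M_α) = Σ_i M_{α_1..α_i} ⊗ M_{α_{i+1}..α_ℓ}, and
    -- R_β^⊥ f = Σ_(f) (R_β , f_(1)) f_(2)
    Rperp : Comp → QS → QS
    Rperp β f = concatMap
      (λ { (a , α) → map (λ i → (a * pair β ((1# , take i α) ∷ []) , drop i α))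
                         (upTo (suc (length α))) })
      f

    summand : ℕ → QS → Comp → PS
    summand m f α p = sgn (size α) * mulPS (FPS (α ⊙ single m)) ⟦ Rperp (ω α) f ⟧ p

module Submission where

-- Both sides are linear in f, so take f = M_γ.  Then R_β^⊥ M_γ =
-- Σ_i (R_β, M_{γ₁⋯γᵢ}) M_{γᵢ₊₁⋯γ_ℓ}, and Möbius inversion
-- M_η = Σ_{E ⊇ D(η)} (−1)^{|E∖D(η)|} F_E makes (R_ω(α), M_η) an explicit signed
-- indicator.  Summing over α then gives (−1)^ℓ(η) G_{rev η}, where G_β sums the
-- monomials of degree |β| + m whose descents among the first |β| − 1 positions
-- lie in D(β).  It remains to show
--   h_m ≺ M_γ = Σ_i (−1)^i G_{rev(γ₁⋯γᵢ)} M_{γᵢ₊₁⋯γ_ℓ},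
-- coefficientwise by induction on the monomial: x₁ may not lie in M_γ alone,
-- and the terms in which x₁ is shared between the two factors telescope.

open import Defs
open import Level using (Level)
open import Algebra.Bundles using (CommutativeRing)
open import Data.Bool using (Bool; true; false; not; _∧_; _∨_; if_then_else_)
open import Data.Bool.Properties using (T-≡; ∧-zeroʳ; ∧-identityʳ) renaming (_≟_ to _≟ᴮ_)
import Data.Nat as Nat
open Nat using (ℕ; zero; suc; _∸_; _<ᵇ_; _≡ᵇ_; _≤_; _<_; _⊓_; z≤n; s≤s)
import Data.Nat.Properties as ℕₚ
open import Data.Bool.ListAction using (and)
open import Data.List using (List; []; _∷_; _++_; _∷ʳ_; map; concatMap; upTo; zipWith;
  replicate; length; reverse; zip; take; drop)
open import Data.List.Properties
open import Data.List.Relation.Unary.All as All using (All; []; _∷_)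
open import Data.List.Relation.Unary.All.Properties using (applyUpTo⁺₁; map⁺; ++⁺; replicate⁺)
open import Data.Maybe using (Maybe; just; nothing)
import Data.Maybe as Maybe
open import Data.Product using (_×_; _,_; proj₂; ∃-syntax)
open import Data.Sum using (_⊎_; inj₁; inj₂)
open import Function using (_∘_; id; mk⇔; Equivalence)
open import Relation.Nullary using (¬_; does)
open import Relation.Nullary.Decidable using (dec-true; dec-false; does-⇔; _×-dec_; ¬?)
import Relation.Binary.PropositionalEquality as ≡
open ≡ using (_≡_; _≢_; refl; cong; cong₂; module ≡-Reasoning)

module Compositions where
  open Nat using (_+_)

  replicate-+ : ∀ {A : Set} j k (x : A) → replicate (j + k) x ≡ replicate j x ++ replicate k x
  replicate-+ zero    k x = refl
  replicate-+ (suc j) k x = cong (x ∷_) (replicate-+ j k x)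

  replicate-++-∷ : ∀ {A : Set} k (x : A) ys → replicate k x ++ x ∷ ys ≡ x ∷ replicate k x ++ ys
  replicate-++-∷ zero    x ys = refl
  replicate-++-∷ (suc k) x ys = cong (x ∷_) (replicate-++-∷ k x ys)

  reverse-replicate : ∀ {A : Set} k (x : A) → reverse (replicate k x) ≡ replicate k x
  reverse-replicate zero    x = refl
  reverse-replicate (suc k) x = begin
    reverse (replicate (suc k) x)  ≡⟨ unfold-reverse x (replicate k x) ⟩
    reverse (replicate k x) ∷ʳ x   ≡⟨ cong (_∷ʳ x) (reverse-replicate k x) ⟩
    replicate k x ++ x ∷ []        ≡⟨ replicate-++-∷ k x [] ⟩
    x ∷ replicate k x ++ []        ≡⟨ cong (x ∷_) (++-identityʳ _) ⟩
    replicate (suc k) x            ∎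
    where open ≡-Reasoning

  length-zipWith-≡ : ∀ {a b d} {A : Set a} {B : Set b} {C : Set d} (f : A → B → C) xs ys →
    length xs ≡ length ys → length (zipWith f xs ys) ≡ length xs
  length-zipWith-≡ f xs ys l =
    ≡.trans (length-zipWith f xs ys) (≡.trans (cong (length xs ⊓_) (≡.sym l)) (ℕₚ.⊓-idem _))

  upTo-< : ∀ n → All (_< n) (upTo n)
  upTo-< n = applyUpTo⁺₁ id n id

  <ᵇ-irrefl : ∀ n → (n <ᵇ n) ≡ false
  <ᵇ-irrefl n = dec-false (n ℕₚ.<? n) (ℕₚ.n≮n n)

  <⇒<ᵇ≡true : ∀ {m n} → m < n → (m <ᵇ n) ≡ true
  <⇒<ᵇ≡true {m} {n} = dec-true (m ℕₚ.<? n)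

  ≡ᵇ≡true⇒≡ : ∀ {m n} → (m ≡ᵇ n) ≡ true → m ≡ n
  ≡ᵇ≡true⇒≡ {m} {n} h = ℕₚ.≡ᵇ⇒≡ m n (Equivalence.from T-≡ h)

  ∸≡ᵇ-swap : ∀ {e k c} → k ≤ e → (e ∸ k ≡ᵇ c) ≡ (k ≡ᵇ e ∸ c) ∧ not (e <ᵇ c)
  ∸≡ᵇ-swap {e} {k} {c} k≤e =
    does-⇔ (mk⇔ to from) (e ∸ k ℕₚ.≟ c) ((k ℕₚ.≟ e ∸ c) ×-dec ¬? (e ℕₚ.<? c))
    where
    to : e ∸ k ≡ c → k ≡ e ∸ c × ¬ e < c
    to refl = ≡.sym (ℕₚ.m∸[m∸n]≡n k≤e) , ℕₚ.≤⇒≯ (ℕₚ.m∸n≤m e k)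
    from : k ≡ e ∸ c × ¬ e < c → e ∸ k ≡ c
    from (refl , e≮c) = ℕₚ.m∸[m∸n]≡n (ℕₚ.≮⇒≥ e≮c)

  -- Inclusion of descent sets given by indicator words, on their common prefix.
  infix 7 _⊆ᵇ_
  _⊆ᵇ_ : List Bool → List Bool → Bool
  []       ⊆ᵇ _        = true
  (x ∷ xs) ⊆ᵇ []       = true
  (x ∷ xs) ⊆ᵇ (y ∷ ys) = (not x ∨ y) ∧ (xs ⊆ᵇ ys)

  ⊆ᵇ-++-falses : ∀ xs k ys → (xs ++ replicate k false) ⊆ᵇ ys ≡ xs ⊆ᵇ ys
  ⊆ᵇ-++-falses []       zero    ys       = refl
  ⊆ᵇ-++-falses []       (suc k) []       = refl
  ⊆ᵇ-++-falses []       (suc k) (y ∷ ys) = ⊆ᵇ-++-falses [] k ys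
  ⊆ᵇ-++-falses (x ∷ xs) k       []       = refl
  ⊆ᵇ-++-falses (x ∷ xs) k       (y ∷ ys) = cong ((not x ∨ y) ∧_) (⊆ᵇ-++-falses xs k ys)

  ⊆ᵇ-takeʳ : ∀ xs ys → xs ⊆ᵇ ys ≡ xs ⊆ᵇ take (length xs) ys
  ⊆ᵇ-takeʳ []       ys       = refl
  ⊆ᵇ-takeʳ (x ∷ xs) []       = refl
  ⊆ᵇ-takeʳ (x ∷ xs) (y ∷ ys) = cong ((not x ∨ y) ∧_) (⊆ᵇ-takeʳ xs ys)

  ⊆ᵇ-takeˡ : ∀ xs ys → xs ⊆ᵇ ys ≡ take (length ys) xs ⊆ᵇ ys
  ⊆ᵇ-takeˡ []       []       = refl
  ⊆ᵇ-takeˡ []       (y ∷ ys) = refl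
  ⊆ᵇ-takeˡ (x ∷ xs) []       = refl
  ⊆ᵇ-takeˡ (x ∷ xs) (y ∷ ys) = cong ((not x ∨ y) ∧_) (⊆ᵇ-takeˡ xs ys)

  ⊆ᵇ-[]ʳ : ∀ xs → xs ⊆ᵇ [] ≡ true
  ⊆ᵇ-[]ʳ []      = refl
  ⊆ᵇ-[]ʳ (x ∷ xs) = refl

  toBools-tail : Comp → List Bool
  toBools-tail []      = []
  toBools-tail (b ∷ φ) = true ∷ toBools (b ∷ φ)

  toBools-∷ : ∀ a φ → toBools (a ∷ φ) ≡ replicate a false ++ toBools-tail φ
  toBools-∷ a []      = ≡.sym (++-identityʳ _)
  toBools-∷ a (b ∷ φ) = refl

  fromBoolsAux-nonempty : ∀ k bs → ∃[ c ] ∃[ cs ] (fromBoolsAux k bs ≡ c ∷ cs)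
  fromBoolsAux-nonempty k []           = k , [] , refl
  fromBoolsAux-nonempty k (false ∷ bs) = fromBoolsAux-nonempty (suc k) bs
  fromBoolsAux-nonempty k (true ∷ bs)  = k , fromBoolsAux 0 bs , refl

  toBools-fromBoolsAux : ∀ k bs → toBools (fromBoolsAux k bs) ≡ replicate k false ++ bs
  toBools-fromBoolsAux k []           = ≡.sym (++-identityʳ _)
  toBools-fromBoolsAux k (false ∷ bs) =
    ≡.trans (toBools-fromBoolsAux (suc k) bs) (≡.sym (replicate-++-∷ k false bs))
  toBools-fromBoolsAux k (true ∷ bs)
    with fromBoolsAux 0 bs | fromBoolsAux-nonempty 0 bs | toBools-fromBoolsAux 0 bs
  ... | .(c ∷ cs) | c , cs , refl | ih = cong (λ z → replicate k false ++ true ∷ z) ih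

  toBools-fromBools : ∀ bs → toBools (fromBools bs) ≡ bs
  toBools-fromBools = toBools-fromBoolsAux 0

  fromBoolsAux-falses : ∀ k a rest →
    fromBoolsAux k (replicate a false ++ rest) ≡ fromBoolsAux (k + a) rest
  fromBoolsAux-falses k zero    rest = cong (λ z → fromBoolsAux z rest) (≡.sym (ℕₚ.+-identityʳ k))
  fromBoolsAux-falses k (suc a) rest =
    ≡.trans (fromBoolsAux-falses (suc k) a rest) (cong (λ z → fromBoolsAux z rest) (≡.sym (ℕₚ.+-suc k a)))

  fromBools-toBools : ∀ a φ → fromBools (toBools (a ∷ φ)) ≡ a ∷ φ
  fromBools-toBools a [] =
    ≡.trans (cong (fromBoolsAux 0) (≡.sym (++-identityʳ (replicate a false)))) (fromBoolsAux-falses 0 a [])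
  fromBools-toBools a (b ∷ φ) =
    ≡.trans (fromBoolsAux-falses 0 a (true ∷ toBools (b ∷ φ))) (cong (a ∷_) (fromBools-toBools b φ))

  size-fromBoolsAux : ∀ k bs → size (fromBoolsAux k bs) ≡ suc (k + length bs)
  size-fromBoolsAux k []           = refl
  size-fromBoolsAux k (false ∷ bs) =
    ≡.trans (size-fromBoolsAux (suc k) bs) (cong suc (≡.sym (ℕₚ.+-suc k (length bs))))
  size-fromBoolsAux k (true ∷ bs)  = cong (λ z → suc (k + z)) (size-fromBoolsAux 0 bs)

  size-fromBools : ∀ bs → size (fromBools bs) ≡ suc (length bs)
  size-fromBools = size-fromBoolsAux 0

  allBools-length : ∀ k → All (λ b → length b ≡ k) (allBools k)
  allBools-length zero    = refl ∷ []
  allBools-length (suc k) = go (allBools k) (allBools-length k)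
    where
    go : ∀ xs → All (λ b → length b ≡ k) xs →
         All (λ b → length b ≡ suc k) (concatMap (λ bs → (false ∷ bs) ∷ (true ∷ bs) ∷ []) xs)
    go []       []         = []
    go (x ∷ xs) (px ∷ pxs) = cong suc px ∷ cong suc px ∷ go xs pxs

  compsOf-size : ∀ n → All (λ α → size α ≡ n) (compsOf n)
  compsOf-size zero    = refl ∷ []
  compsOf-size (suc n) = map⁺ (go (allBools-length n))
    where
    go : ∀ {bs} → All (λ b → length b ≡ n) bs → All (λ b → size (fromBools b) ≡ suc n) bs
    go {[]}     []         = []
    go {b ∷ bs} (lb ∷ lbs) = ≡.trans (size-fromBools b) (cong suc lb) ∷ go lbs

  suc-length-toBools : ∀ a φ → suc (length (toBools (a ∷ φ))) ≡ size (a ∷ φ)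
  suc-length-toBools a φ = ≡.trans (≡.sym (size-fromBools (toBools (a ∷ φ)))) (cong size (fromBools-toBools a φ))

  length-toBools : ∀ φ {n} → size φ ≡ suc n → length (toBools φ) ≡ n
  length-toBools (b ∷ ψ) e = ℕₚ.suc-injective (≡.trans (suc-length-toBools b ψ) e)

  toBools-++ : ∀ a α b β → toBools ((a ∷ α) ++ (b ∷ β)) ≡ toBools (a ∷ α) ++ true ∷ toBools (b ∷ β)
  toBools-++ a []       b β = refl
  toBools-++ a (a' ∷ α) b β =
    ≡.trans (cong (λ z → replicate a false ++ true ∷ z) (toBools-++ a' α b β))
          (≡.sym (++-assoc (replicate a false) (true ∷ toBools (a' ∷ α)) _))

  reverse-nonempty : ∀ {A : Set} (a : A) α → ∃[ c ] ∃[ cs ] (reverse (a ∷ α) ≡ c ∷ cs)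
  reverse-nonempty a α with reverse α | unfold-reverse a α
  ... | []     | e = a , [] , e
  ... | c ∷ cs | e = c , cs ++ a ∷ [] , e

  toBools-reverse : ∀ α → toBools (reverse α) ≡ reverse (toBools α)
  toBools-reverse []           = refl
  toBools-reverse (a ∷ [])     = ≡.sym (reverse-replicate a false)
  toBools-reverse (a ∷ a' ∷ α)
    with reverse (a' ∷ α) | reverse-nonempty a' α | toBools-reverse (a' ∷ α) | unfold-reverse a (a' ∷ α)
  ... | .(c ∷ cs) | c , cs , refl | ih | e = begin
    toBools (reverse (a ∷ a' ∷ α))                                     ≡⟨ cong toBools e ⟩
    toBools ((c ∷ cs) ++ a ∷ [])                                       ≡⟨ toBools-++ c cs a [] ⟩
    toBools (c ∷ cs) ++ true ∷ replicate a false                       ≡⟨ cong (_++ true ∷ replicate a false) ih ⟩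
    reverse (toBools (a' ∷ α)) ++ true ∷ replicate a false
      ≡⟨ ≡.sym (++-assoc (reverse (toBools (a' ∷ α))) (true ∷ []) (replicate a false)) ⟩
    (reverse (toBools (a' ∷ α)) ∷ʳ true) ++ replicate a false
      ≡⟨ cong₂ _++_ (≡.sym (unfold-reverse true (toBools (a' ∷ α)))) (≡.sym (reverse-replicate a false)) ⟩
    reverse (true ∷ toBools (a' ∷ α)) ++ reverse (replicate a false)
      ≡⟨ ≡.sym (reverse-++ (replicate a false) (true ∷ toBools (a' ∷ α))) ⟩
    reverse (toBools (a ∷ a' ∷ α))                                     ∎
    where open ≡-Reasoning

  size-via-toBools : ∀ {α β} → (∃[ a ] ∃[ φ ] α ≡ a ∷ φ) → (∃[ b ] ∃[ ψ ] β ≡ b ∷ ψ) →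
    length (toBools α) ≡ length (toBools β) → size α ≡ size β
  size-via-toBools (a , φ , refl) (b , ψ , refl) e =
    ≡.trans (≡.sym (suc-length-toBools a φ)) (≡.trans (cong suc e) (suc-length-toBools b ψ))

  size-reverse : ∀ α → size (reverse α) ≡ size α
  size-reverse []      = refl
  size-reverse (a ∷ α) = size-via-toBools (reverse-nonempty a α) (a , α , refl)
    (≡.trans (cong length (toBools-reverse (a ∷ α))) (length-reverse (toBools (a ∷ α))))

  ⊙-nonempty : ∀ a α m → ∃[ c ] ∃[ cs ] ((a ∷ α) ⊙ (m ∷ []) ≡ c ∷ cs)
  ⊙-nonempty a []       m = _ , _ , refl
  ⊙-nonempty a (a' ∷ α) m = _ , _ , refl

  toBools-⊙ : ∀ a α m → toBools ((a ∷ α) ⊙ (m ∷ [])) ≡ toBools (a ∷ α) ++ replicate (suc m) false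
  toBools-⊙ a [] m =
    ≡.trans (cong (λ z → replicate z false) (≡.trans (ℕₚ.+-assoc a m 1) (cong (a +_) (ℕₚ.+-comm m 1))))
          (replicate-+ a (suc m) false)
  toBools-⊙ a (a' ∷ α) m
    with (a' ∷ α) ⊙ (m ∷ []) | ⊙-nonempty a' α m | toBools-⊙ a' α m
  ... | .(c ∷ cs) | c , cs , refl | ih =
    ≡.trans (cong (λ z → replicate a false ++ true ∷ z) ih)
          (≡.sym (++-assoc (replicate a false) (true ∷ toBools (a' ∷ α)) _))

  size-⊙ : ∀ a α m → size ((a ∷ α) ⊙ (m ∷ [])) ≡ size (a ∷ α) + suc m
  size-⊙ a α m with (a ∷ α) ⊙ (m ∷ []) | ⊙-nonempty a α m | toBools-⊙ a α m
  ... | .(c ∷ cs) | c , cs , refl | e =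
    ≡.trans (≡.sym (suc-length-toBools c cs)) (≡.trans (cong (λ z → suc (length z)) e)
      (≡.trans (cong suc (length-++ (toBools (a ∷ α))))
        (cong₂ _+_ (suc-length-toBools a α) (length-replicate (suc m)))))

  toBools-ω : ∀ a α → toBools (ω (a ∷ α)) ≡ map not (reverse (toBools (a ∷ α)))
  toBools-ω a α = ≡.trans (toBools-fromBools _) (cong (map not) (toBools-reverse (a ∷ α)))

  size-ω : ∀ α → size (ω α) ≡ size α
  size-ω []      = refl
  size-ω (a ∷ α) = begin
    size (fromBools (map not (toBools (reverse (a ∷ α)))))  ≡⟨ size-fromBools (map not (toBools (reverse (a ∷ α)))) ⟩
    suc (length (map not (toBools (reverse (a ∷ α)))))     ≡⟨ cong suc (length-map not (toBools (reverse (a ∷ α)))) ⟩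
    suc (length (toBools (reverse (a ∷ α))))               ≡⟨ cong (λ z → suc (length z)) (toBools-reverse (a ∷ α)) ⟩
    suc (length (reverse (toBools (a ∷ α))))               ≡⟨ cong suc (length-reverse (toBools (a ∷ α))) ⟩
    suc (length (toBools (a ∷ α)))                         ≡⟨ suc-length-toBools a α ⟩
    size (a ∷ α)                                           ∎
    where open ≡-Reasoning

  countFalse : List Bool → ℕ
  countFalse []          = 0
  countFalse (true ∷ l)  = countFalse l
  countFalse (false ∷ l) = suc (countFalse l)

  countFalse-++ : ∀ xs ys → countFalse (xs ++ ys) ≡ countFalse xs + countFalse ys
  countFalse-++ []           ys = refl
  countFalse-++ (true ∷ xs)  ys = countFalse-++ xs ys
  countFalse-++ (false ∷ xs) ys = cong suc (countFalse-++ xs ys)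

  countFalse-replicate : ∀ k → countFalse (replicate k false) ≡ k
  countFalse-replicate zero    = refl
  countFalse-replicate (suc k) = cong suc (countFalse-replicate k)

  countFalse-reverse : ∀ l → countFalse (reverse l) ≡ countFalse l
  countFalse-reverse []      = refl
  countFalse-reverse (x ∷ l) = begin
    countFalse (reverse (x ∷ l))                 ≡⟨ cong countFalse (unfold-reverse x l) ⟩
    countFalse (reverse l ++ x ∷ [])             ≡⟨ countFalse-++ (reverse l) (x ∷ []) ⟩
    countFalse (reverse l) + countFalse (x ∷ []) ≡⟨ cong (_+ countFalse (x ∷ [])) (countFalse-reverse l) ⟩
    countFalse l + countFalse (x ∷ [])           ≡⟨ last x ⟩
    countFalse (x ∷ l)                           ∎
    where
    open ≡-Reasoning
    last : ∀ x → countFalse l + countFalse (x ∷ []) ≡ countFalse (x ∷ l)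
    last true  = ℕₚ.+-identityʳ _
    last false = ℕₚ.+-comm (countFalse l) 1

  -- A part a+1 contributes a non-descents; the ℓ parts account for the rest.
  countFalse-toBools : ∀ a δ → countFalse (toBools (a ∷ δ)) + length (a ∷ δ) ≡ size (a ∷ δ)
  countFalse-toBools a [] =
    ≡.trans (cong (_+ 1) (countFalse-replicate a)) (≡.trans (ℕₚ.+-comm a 1) (cong suc (≡.sym (ℕₚ.+-identityʳ a))))
  countFalse-toBools a (b ∷ δ) = begin
    countFalse (replicate a false ++ true ∷ toBools (b ∷ δ)) + suc (length (b ∷ δ))
      ≡⟨ cong (_+ suc (length (b ∷ δ))) (countFalse-++ (replicate a false) (true ∷ toBools (b ∷ δ))) ⟩
    (countFalse (replicate a false) + countFalse (toBools (b ∷ δ))) + suc (length (b ∷ δ))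
      ≡⟨ cong (λ z → (z + countFalse (toBools (b ∷ δ))) + suc (length (b ∷ δ))) (countFalse-replicate a) ⟩
    (a + countFalse (toBools (b ∷ δ))) + suc (length (b ∷ δ))
      ≡⟨ ℕₚ.+-suc (a + countFalse (toBools (b ∷ δ))) (length (b ∷ δ)) ⟩
    suc ((a + countFalse (toBools (b ∷ δ))) + length (b ∷ δ))
      ≡⟨ cong suc (ℕₚ.+-assoc a (countFalse (toBools (b ∷ δ))) (length (b ∷ δ))) ⟩
    suc (a + (countFalse (toBools (b ∷ δ)) + length (b ∷ δ)))
      ≡⟨ cong (λ z → suc (a + z)) (countFalse-toBools b δ) ⟩
    size (a ∷ b ∷ δ)
      ∎
    where open ≡-Reasoning

  ==-refl : ∀ α → (α == α) ≡ true
  ==-refl α = dec-true (≡-dec ℕₚ._≟_ α α) refl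

  ==-≢ : ∀ {α β} → α ≢ β → (α == β) ≡ false
  ==-≢ {α} {β} = dec-false (≡-dec ℕₚ._≟_ α β)

  ==-sym : ∀ α β → (α == β) ≡ (β == α)
  ==-sym α β = does-⇔ (mk⇔ ≡.sym ≡.sym) (≡-dec ℕₚ._≟_ α β) (≡-dec ℕₚ._≟_ β α)

  infix 4 _==ᴮ_
  _==ᴮ_ : List Bool → List Bool → Bool
  xs ==ᴮ ys = does (≡-dec _≟ᴮ_ xs ys)

  ==ᴮ-sym : ∀ xs ys → (xs ==ᴮ ys) ≡ (ys ==ᴮ xs)
  ==ᴮ-sym xs ys = does-⇔ (mk⇔ ≡.sym ≡.sym) (≡-dec _≟ᴮ_ xs ys) (≡-dec _≟ᴮ_ ys xs)

  ==-fromBools : ∀ φ bs → (φ == fromBools bs) ≡ (size φ ≡ᵇ suc (length bs)) ∧ (toBools φ ==ᴮ bs)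
  ==-fromBools φ bs = does-⇔ (mk⇔ to (from φ)) (≡-dec ℕₚ._≟_ φ (fromBools bs))
    ((size φ ℕₚ.≟ suc (length bs)) ×-dec ≡-dec _≟ᴮ_ (toBools φ) bs)
    where
    to : φ ≡ fromBools bs → size φ ≡ suc (length bs) × toBools φ ≡ bs
    to refl = size-fromBools bs , toBools-fromBools bs
    from : ∀ φ → size φ ≡ suc (length bs) × toBools φ ≡ bs → φ ≡ fromBools bs
    from []      (() , _)
    from (a ∷ ψ) (_ , refl) = ≡.sym (fromBools-toBools a ψ)

  []==-size : ∀ β → ([] == β) ≡ (size β ≡ᵇ 0)
  []==-size []      = refl
  []==-size (b ∷ β) = refl

  degree-flat : ∀ p → degree p ≡ size (flat p)
  degree-flat []          = refl
  degree-flat (zero ∷ p)  = degree-flat p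
  degree-flat (suc e ∷ p) = cong (λ z → suc (e + z)) (degree-flat p)

  length-seqFrom : ∀ i p → length (seqFrom i p) ≡ degree p
  length-seqFrom i []      = refl
  length-seqFrom i (e ∷ p) =
    ≡.trans (length-++ (replicate e i)) (cong₂ _+_ (length-replicate e) (length-seqFrom (suc i) p))

  seqFrom-≥ : ∀ i p → All (i ≤_) (seqFrom i p)
  seqFrom-≥ i []      = []
  seqFrom-≥ i (e ∷ p) =
    ++⁺ (replicate⁺ e ℕₚ.≤-refl) (All.map (ℕₚ.≤-trans (ℕₚ.n≤1+n i)) (seqFrom-≥ (suc i) p))

  ascents : List ℕ → List Bool
  ascents (x ∷ y ∷ r) = (x <ᵇ y) ∷ ascents (y ∷ r)
  ascents _           = []

  ascents-tail : List ℕ → List Bool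
  ascents-tail []       = []
  ascents-tail (y ∷ ys) = true ∷ ascents (y ∷ ys)

  ascents-replicate : ∀ a i ys → All (suc i ≤_) ys →
    ascents (replicate (suc a) i ++ ys) ≡ replicate a false ++ ascents-tail ys
  ascents-replicate zero    i []       _        = refl
  ascents-replicate zero    i (y ∷ ys) (i<y ∷ _) = cong (_∷ ascents (y ∷ ys)) (<⇒<ᵇ≡true i<y)
  ascents-replicate (suc a) i ys       h        = cong₂ _∷_ (<ᵇ-irrefl i) (ascents-replicate a i ys h)

  ascents-tail-toBools : ∀ xs φ → ascents xs ≡ toBools φ → length xs ≡ size φ →
    ascents-tail xs ≡ toBools-tail φ
  ascents-tail-toBools []       []      _ _  = refl
  ascents-tail-toBools (y ∷ xs) (b ∷ φ) e _  = cong (true ∷_) e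

  ascents-seqFrom : ∀ i p → ascents (seqFrom i p) ≡ toBools (flat p)
  ascents-seqFrom i []          = refl
  ascents-seqFrom i (zero ∷ p)  = ascents-seqFrom (suc i) p
  ascents-seqFrom i (suc a ∷ p) = begin
    ascents (seqFrom i (suc a ∷ p))
      ≡⟨ ascents-replicate a i (seqFrom (suc i) p) (seqFrom-≥ (suc i) p) ⟩
    replicate a false ++ ascents-tail (seqFrom (suc i) p)
      ≡⟨ cong (replicate a false ++_) (ascents-tail-toBools (seqFrom (suc i) p) (flat p)
           (ascents-seqFrom (suc i) p) (≡.trans (length-seqFrom (suc i) p) (degree-flat p))) ⟩
    replicate a false ++ toBools-tail (flat p)
      ≡⟨ toBools-∷ a (flat p) ⟨
    toBools (flat (suc a ∷ p))
      ∎
    where open ≡-Reasoning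

  and-zip-consecutive : (g : Bool × (ℕ × ℕ) → Bool) →
    (∀ b s t → g (b , (s , t)) ≡ (if b then s <ᵇ t else true)) →
    ∀ bs xs → and (map g (zip bs (consecutive xs))) ≡ bs ⊆ᵇ ascents xs
  and-zip-consecutive g hg []           xs          = refl
  and-zip-consecutive g hg (b ∷ bs)     []          = refl
  and-zip-consecutive g hg (b ∷ bs)     (x ∷ [])    = refl
  and-zip-consecutive g hg (true ∷ bs)  (x ∷ y ∷ r) rewrite hg true x y =
    cong ((x <ᵇ y) ∧_) (and-zip-consecutive g hg bs (y ∷ r))
  and-zip-consecutive g hg (false ∷ bs) (x ∷ y ∷ r) rewrite hg false x y =
    and-zip-consecutive g hg bs (y ∷ r)

  -- F_α(p) = 1 iff flat p refines α: same size and D(α) ⊆ D(flat p).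
  refines : Comp → Comp → Bool
  refines α φ = (size φ ≡ᵇ size α) ∧ (toBools α ⊆ᵇ toBools φ)

  FCond-flat : ∀ α p → FCond α p ≡ refines α (flat p)
  FCond-flat α p =
    cong₂ _∧_ (cong (_≡ᵇ size α) (≡.trans (length-seqFrom 1 p) (degree-flat p)))
              (≡.trans (and-zip-consecutive _ (λ _ _ _ → refl) (toBools α) (indexSeq p))
                     (cong (toBools α ⊆ᵇ_) (ascents-seqFrom 1 p)))

  -- G_β(u) = [within m β (flat u)], where within m β φ says |φ| = |β| + m and
  -- D(φ) ⊆ D(β) on the first |β| − 1 positions.
  within : ℕ → Comp → Comp → Bool
  within m β φ = (size φ ≡ᵇ size β + m) ∧ (toBools φ ⊆ᵇ toBools β)

  prependPart : ℕ → Comp → Comp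
  prependPart zero    φ = φ
  prependPart (suc t) φ = t ∷ φ

  flat-∷ : ∀ k u → flat (k ∷ u) ≡ prependPart k (flat u)
  flat-∷ zero    u = refl
  flat-∷ (suc k) u = refl

  within-[]ˡ : ∀ m φ → within m [] φ ≡ (size φ ≡ᵇ m)
  within-[]ˡ m φ = ≡.trans (cong ((size φ ≡ᵇ m) ∧_) (⊆ᵇ-[]ʳ (toBools φ))) (∧-identityʳ _)

  within-[]ʳ : ∀ m' β → within (suc m') β [] ≡ false
  within-[]ʳ m' β rewrite ℕₚ.+-suc (size β) m' = refl

  within-suc : ∀ m c β e φ → within m (suc c ∷ β) (suc e ∷ φ) ≡ within m (c ∷ β) (e ∷ φ)
  within-suc m c β e φ rewrite toBools-∷ (suc c) β | toBools-∷ (suc e) φ | toBools-∷ c β | toBools-∷ e φ = refl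

  within-∷ : ∀ m c β e φ →
    within m (c ∷ β) (e ∷ φ) ≡ (if e <ᵇ c then false else within m β (prependPart (e ∸ c) φ))
  within-∷ m zero    []      zero    []      = refl
  within-∷ m zero    []      zero    (b ∷ φ) = cong ((size (0 ∷ b ∷ φ) ≡ᵇ 1 + m) ∧_) (≡.sym (⊆ᵇ-[]ʳ (toBools (b ∷ φ))))
  within-∷ m zero    (a ∷ β) zero    []      = refl
  within-∷ m zero    (a ∷ β) zero    (b ∷ φ) = refl
  within-∷ m (suc c) β       zero    []      = refl
  within-∷ m (suc c) β       zero    (b ∷ φ) rewrite toBools-∷ (suc c) β = ∧-zeroʳ _
  within-∷ m zero    []      (suc e) φ       =
    cong ((size (suc e ∷ φ) ≡ᵇ 1 + m) ∧_) (≡.trans (⊆ᵇ-[]ʳ (toBools (suc e ∷ φ))) (≡.sym (⊆ᵇ-[]ʳ (toBools (e ∷ φ)))))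
  within-∷ m zero    (a ∷ β) (suc e) φ       rewrite toBools-∷ (suc e) φ | toBools-∷ e φ = refl
  within-∷ m (suc c) β       (suc e) φ       = ≡.trans (within-suc m c β e φ) (within-∷ m c β e φ)

  compareMin : Maybe ℕ → Maybe ℕ → Bool
  compareMin nothing  _        = false
  compareMin (just i) nothing  = true
  compareMin (just i) (just j) = i <ᵇ j

  minLt-compareMin : ∀ d r → minLt d r ≡ compareMin (minSupp d) (minSupp r)
  minLt-compareMin d r with minSupp d | minSupp r
  ... | nothing | _       = refl
  ... | just i  | nothing = refl
  ... | just i  | just j  = refl

  minSuppFrom-suc : ∀ i d → minSuppFrom (suc i) d ≡ Maybe.map suc (minSuppFrom i d)
  minSuppFrom-suc i []          = refl
  minSuppFrom-suc i (zero ∷ d)  = minSuppFrom-suc (suc i) d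
  minSuppFrom-suc i (suc e ∷ d) = refl

  compareMin-suc : ∀ x y → compareMin (Maybe.map suc x) (Maybe.map suc y) ≡ compareMin x y
  compareMin-suc nothing  y        = refl
  compareMin-suc (just i) nothing  = refl
  compareMin-suc (just i) (just j) = refl

  minSuppFrom-≥ : ∀ i d → minSuppFrom i d ≡ nothing ⊎ ∃[ t ] minSuppFrom i d ≡ just (i + t)
  minSuppFrom-≥ i []          = inj₁ refl
  minSuppFrom-≥ i (zero ∷ d)  with minSuppFrom-≥ (suc i) d
  ... | inj₁ e       = inj₁ e
  ... | inj₂ (t , e) = inj₂ (suc t , ≡.trans e (cong just (≡.sym (ℕₚ.+-suc i t))))
  minSuppFrom-≥ i (suc e ∷ d) = inj₂ (0 , cong just (≡.sym (ℕₚ.+-identityʳ i)))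

  minLt-0∷0∷ : ∀ d r → minLt (0 ∷ d) (0 ∷ r) ≡ minLt d r
  minLt-0∷0∷ d r = begin
    minLt (0 ∷ d) (0 ∷ r)                                                ≡⟨ minLt-compareMin (0 ∷ d) (0 ∷ r) ⟩
    compareMin (minSuppFrom 2 d) (minSuppFrom 2 r)                       ≡⟨ cong₂ compareMin (minSuppFrom-suc 1 d) (minSuppFrom-suc 1 r) ⟩
    compareMin (Maybe.map suc (minSupp d)) (Maybe.map suc (minSupp r))  ≡⟨ compareMin-suc (minSupp d) (minSupp r) ⟩
    compareMin (minSupp d) (minSupp r)                                   ≡⟨ minLt-compareMin d r ⟨
    minLt d r                                                            ∎
    where open ≡-Reasoning

  minLt-∷-suc∷ : ∀ k t d r → minLt (k ∷ d) (suc t ∷ r) ≡ false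
  minLt-∷-suc∷ (suc k) t d r = refl
  minLt-∷-suc∷ zero    t d r = ≡.trans (minLt-compareMin (0 ∷ d) (suc t ∷ r)) (go (minSuppFrom-≥ 2 d))
    where
    go : minSuppFrom 2 d ≡ nothing ⊎ ∃[ s ] minSuppFrom 2 d ≡ just (2 + s) →
         compareMin (minSuppFrom 2 d) (just 1) ≡ false
    go (inj₁ e)       rewrite e = refl
    go (inj₂ (s , e)) rewrite e = refl

  minLt-suc∷-0∷ : ∀ e d r → minLt (suc e ∷ d) (0 ∷ r) ≡ true
  minLt-suc∷-0∷ e d r = ≡.trans (minLt-compareMin (suc e ∷ d) (0 ∷ r)) (go (minSuppFrom-≥ 2 r))
    where
    go : minSuppFrom 2 r ≡ nothing ⊎ ∃[ s ] minSuppFrom 2 r ≡ just (2 + s) →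
         compareMin (just 1) (minSuppFrom 2 r) ≡ true
    go (inj₁ e)       rewrite e = refl
    go (inj₂ (s , e)) rewrite e = refl

  drop-nonempty : ∀ i (γ : Comp) → i < length γ → ∃[ c ] ∃[ γ' ] drop i γ ≡ c ∷ γ'
  drop-nonempty zero    (x ∷ γ) _         = x , γ , refl
  drop-nonempty (suc i) (x ∷ γ) (s≤s lt) = drop-nonempty i γ lt

  drop-suc-∷ : ∀ i (γ : Comp) {c γ'} → drop i γ ≡ c ∷ γ' → drop (suc i) γ ≡ γ'
  drop-suc-∷ zero    (x ∷ γ) refl = refl
  drop-suc-∷ (suc i) (x ∷ γ) e    = drop-suc-∷ i γ e

  reverse-take-suc-∷ : ∀ i (γ : Comp) {c γ'} → drop i γ ≡ c ∷ γ' →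
    reverse (take (suc i) γ) ≡ c ∷ reverse (take i γ)
  reverse-take-suc-∷ i γ {c} e = ≡.trans (cong reverse (take-suc-∷ i γ e)) (reverse-++ (take i γ) (c ∷ []))
    where
    take-suc-∷ : ∀ i (γ : Comp) {c γ'} → drop i γ ≡ c ∷ γ' → take (suc i) γ ≡ take i γ ++ c ∷ []
    take-suc-∷ zero    (x ∷ γ) refl = refl
    take-suc-∷ (suc i) (x ∷ γ) e    = cong (x ∷_) (take-suc-∷ i γ e)

  size-take : ∀ i (γ : Comp) → size (take i γ) ≤ size γ
  size-take zero    γ       = z≤n
  size-take (suc i) []      = z≤n
  size-take (suc i) (x ∷ γ) = s≤s (ℕₚ.+-monoʳ-≤ x (size-take i γ))

  length-take-≤ : ∀ i (γ : Comp) → i ≤ length γ → length (take i γ) ≡ i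
  length-take-≤ zero    γ       _        = refl
  length-take-≤ (suc i) (x ∷ γ) (s≤s le) = cong suc (length-take-≤ i γ le)

open Compositions

module _ {r ℓ : Level} (R : CommutativeRing r ℓ) where
  open CommutativeRing R renaming (refl to ≈-refl)
  open import Relation.Binary.Reasoning.Setoid setoid
  open import Algebra.Properties.Ring ring using (-‿distribˡ-*; -‿distribʳ-*; x+x≈x⇒x≈0)
  open import Algebra.Properties.AbelianGroup +-abelianGroup using (⁻¹-∙-comm)
  open import Algebra.Properties.Group +-group using (⁻¹-involutive; ε⁻¹≈ε)
  open import Algebra.Properties.CommutativeSemigroup *-commutativeSemigroup using (x∙yz≈y∙xz)
  open import Algebra.Properties.CommutativeSemigroup +-commutativeSemigroup using (interchange)

  Σ-cong : ∀ {a} {A : Set a} (xs : List A) {g h : A → Carrier} →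
    (∀ x → g x ≈ h x) → Σ R xs g ≈ Σ R xs h
  Σ-cong []       e = ≈-refl
  Σ-cong (x ∷ xs) e = +-cong (e x) (Σ-cong xs e)

  Σ-congᴬ : ∀ {a p} {A : Set a} {P : A → Set p} {xs : List A} {g h : A → Carrier} →
    All P xs → (∀ x → P x → g x ≈ h x) → Σ R xs g ≈ Σ R xs h
  Σ-congᴬ []         e = ≈-refl
  Σ-congᴬ (px ∷ pxs) e = +-cong (e _ px) (Σ-congᴬ pxs e)

  Σ-zero : ∀ {a} {A : Set a} (xs : List A) {g : A → Carrier} → (∀ x → g x ≈ 0#) → Σ R xs g ≈ 0#
  Σ-zero []       e = ≈-refl
  Σ-zero (x ∷ xs) e = trans (+-cong (e x) (Σ-zero xs e)) (+-identityˡ _)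

  Σ-++ : ∀ {a} {A : Set a} (xs ys : List A) (g : A → Carrier) → Σ R (xs ++ ys) g ≈ Σ R xs g + Σ R ys g
  Σ-++ []       ys g = sym (+-identityˡ _)
  Σ-++ (x ∷ xs) ys g = trans (+-congˡ (Σ-++ xs ys g)) (sym (+-assoc _ _ _))

  Σ-concatMap : ∀ {a b} {A : Set a} {B : Set b} (f : A → List B) (xs : List A) (g : B → Carrier) →
    Σ R (concatMap f xs) g ≈ Σ R xs (λ x → Σ R (f x) g)
  Σ-concatMap f []       g = ≈-refl
  Σ-concatMap f (x ∷ xs) g = trans (Σ-++ (f x) (concatMap f xs) g) (+-congˡ (Σ-concatMap f xs g))

  Σ-map : ∀ {a b} {A : Set a} {B : Set b} (f : A → B) (xs : List A) (g : B → Carrier) →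
    Σ R (map f xs) g ≡ Σ R xs (g ∘ f)
  Σ-map f []       g = refl
  Σ-map f (x ∷ xs) g = cong (g (f x) +_) (Σ-map f xs g)

  Σ-+ : ∀ {a} {A : Set a} (xs : List A) (g h : A → Carrier) →
    Σ R xs (λ x → g x + h x) ≈ Σ R xs g + Σ R xs h
  Σ-+ []       g h = sym (+-identityˡ _)
  Σ-+ (x ∷ xs) g h = trans (+-congˡ (Σ-+ xs g h)) (interchange _ _ _ _)

  *-Σ : ∀ {a} {A : Set a} (k : Carrier) (xs : List A) (g : A → Carrier) →
    k * Σ R xs g ≈ Σ R xs (λ x → k * g x)
  *-Σ k []       g = zeroʳ k
  *-Σ k (x ∷ xs) g = trans (distribˡ k _ _) (+-congˡ (*-Σ k xs g))

  Σ-* : ∀ {a} {A : Set a} (k : Carrier) (xs : List A) (g : A → Carrier) →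
    Σ R xs g * k ≈ Σ R xs (λ x → g x * k)
  Σ-* k []       g = zeroˡ k
  Σ-* k (x ∷ xs) g = trans (distribʳ k _ _) (+-congˡ (Σ-* k xs g))

  Σ-neg : ∀ {a} {A : Set a} (xs : List A) (g : A → Carrier) → Σ R xs (λ x → - g x) ≈ - Σ R xs g
  Σ-neg []       g = sym ε⁻¹≈ε
  Σ-neg (x ∷ xs) g = trans (+-congˡ (Σ-neg xs g)) (⁻¹-∙-comm (g x) (Σ R xs g))

  Σ-comm : ∀ {a b} {A : Set a} {B : Set b} (xs : List A) (ys : List B) (g : A → B → Carrier) →
    Σ R xs (λ x → Σ R ys (g x)) ≈ Σ R ys (λ y → Σ R xs (λ x → g x y))
  Σ-comm []       ys g = sym (Σ-zero ys (λ _ → ≈-refl))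
  Σ-comm (x ∷ xs) ys g =
    trans (+-congˡ (Σ-comm xs ys g)) (sym (Σ-+ ys (g x) (λ y → Σ R xs (λ x' → g x' y))))

  Σ-upTo-suc : ∀ n (g : ℕ → Carrier) → Σ R (upTo (suc n)) g ≈ g 0 + Σ R (upTo n) (g ∘ suc)
  Σ-upTo-suc n g = +-congˡ (reflexive (≡.trans (≡.sym (cong (λ l → Σ R l g) (map-upTo suc n)))
                                                 (Σ-map suc (upTo n) g)))

  Σ-upTo-∷ʳ : ∀ n (g : ℕ → Carrier) → Σ R (upTo (suc n)) g ≈ Σ R (upTo n) g + g n
  Σ-upTo-∷ʳ n g = begin
    Σ R (upTo (suc n)) g          ≡⟨ cong (λ l → Σ R l g) (upTo-∷ʳ n) ⟨
    Σ R (upTo n ++ n ∷ []) g      ≈⟨ Σ-++ (upTo n) (n ∷ []) g ⟩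
    Σ R (upTo n) g + (g n + 0#)   ≈⟨ +-congˡ (+-identityʳ _) ⟩
    Σ R (upTo n) g + g n          ∎

  δ-∧ : ∀ x y → δ R (x ∧ y) ≈ δ R x * δ R y
  δ-∧ true  y = sym (*-identityˡ _)
  δ-∧ false y = sym (zeroˡ _)

  δ-if : ∀ b z → δ R (if b then false else z) ≈ δ R (not b) * δ R z
  δ-if true  z = sym (zeroˡ _)
  δ-if false z = sym (*-identityˡ _)

  δ-idem : ∀ x y → δ R x * (δ R x * y) ≈ δ R x * y
  δ-idem true  y = *-congˡ (*-identityˡ y)
  δ-idem false y = trans (zeroˡ _) (sym (zeroˡ _))

  δ-guard : ∀ x {y z} → (x ≡ true → y ≈ z) → δ R x * y ≈ δ R x * z
  δ-guard true  h = *-congˡ (h refl)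
  δ-guard false h = trans (zeroˡ _) (sym (zeroˡ _))

  δ-absorb : ∀ x {y z} → y ≈ δ R x * z → y ≈ δ R x * y
  δ-absorb x {y} {z} h = trans h (trans (sym (δ-idem x z)) (*-congˡ (sym h)))

  Σ-upTo-δ : ∀ n j (g : ℕ → Carrier) → Σ R (upTo n) (λ k → δ R (k ≡ᵇ j) * g k) ≈ δ R (j <ᵇ n) * g j
  Σ-upTo-δ zero    j       g = sym (zeroˡ _)
  Σ-upTo-δ (suc n) zero    g = begin
    Σ R (upTo (suc n)) (λ k → δ R (k ≡ᵇ 0) * g k)                    ≈⟨ Σ-upTo-suc n _ ⟩
    1# * g 0 + Σ R (upTo n) (λ k → δ R (suc k ≡ᵇ 0) * g (suc k))     ≈⟨ +-cong (*-identityˡ _) (Σ-zero (upTo n) (λ _ → zeroˡ _)) ⟩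
    g 0 + 0#                                                         ≈⟨ +-identityʳ _ ⟩
    g 0                                                              ≈⟨ *-identityˡ _ ⟨
    1# * g 0                                                         ∎
  Σ-upTo-δ (suc n) (suc j) g =
    trans (Σ-upTo-suc n _) (trans (+-cong (zeroˡ _) (Σ-upTo-δ n j (g ∘ suc))) (+-identityˡ _))

  -‿*-comm : ∀ x y → - x * y ≈ - (x * y)
  -‿*-comm x y = sym (-‿distribˡ-* x y)

  sgn-+ : ∀ a b → sgn R (a Nat.+ b) ≈ sgn R a * sgn R b
  sgn-+ zero    b = sym (*-identityˡ _)
  sgn-+ (suc a) b = trans (-‿cong (sgn-+ a b)) (sym (-‿*-comm _ _))

  sgn-square : ∀ a → sgn R a * sgn R a ≈ 1#
  sgn-square zero    = *-identityˡ _
  sgn-square (suc a) = begin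
    - sgn R a * - sgn R a       ≈⟨ -‿*-comm _ _ ⟩
    - (sgn R a * - sgn R a)     ≈⟨ -‿cong (-‿distribʳ-* _ _) ⟨
    - - (sgn R a * sgn R a)     ≈⟨ ⁻¹-involutive _ ⟩
    sgn R a * sgn R a           ≈⟨ sgn-square a ⟩
    1#                          ∎

  Σ-alternating-telescope : ∀ L (B C : ℕ → Carrier) → (∀ i → i < L → C i ≈ B (suc i)) → C L ≈ 0# →
    Σ R (upTo (suc L)) (λ i → sgn R i * (B i + C i)) ≈ B 0
  Σ-alternating-telescope zero B C h hL =
    trans (+-identityʳ _) (trans (*-identityˡ _) (trans (+-congˡ hL) (+-identityʳ _)))
  Σ-alternating-telescope (suc L) B C h hL = begin
    Σ R (upTo (suc (suc L))) (λ i → sgn R i * (B i + C i))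
      ≈⟨ Σ-upTo-suc (suc L) _ ⟩
    1# * (B 0 + C 0) + Σ R (upTo (suc L)) (λ i → - sgn R i * (B (suc i) + C (suc i)))
      ≈⟨ +-cong (*-identityˡ _) (trans (Σ-cong (upTo (suc L)) (λ i → -‿*-comm _ _)) (Σ-neg (upTo (suc L)) _)) ⟩
    (B 0 + C 0) + - Σ R (upTo (suc L)) (λ i → sgn R i * (B (suc i) + C (suc i)))
      ≈⟨ +-congˡ (-‿cong (Σ-alternating-telescope L (B ∘ suc) (C ∘ suc) (λ i lt → h (suc i) (s≤s lt)) hL)) ⟩
    (B 0 + C 0) + - B 1
      ≈⟨ +-assoc _ _ _ ⟩
    B 0 + (C 0 + - B 1)
      ≈⟨ +-congˡ (trans (+-congʳ (h 0 (s≤s z≤n))) (-‿inverseʳ _)) ⟩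
    B 0 + 0#
      ≈⟨ +-identityʳ _ ⟩
    B 0
      ∎

  weight : List (Bool → Carrier) → List Bool → Carrier
  weight (w ∷ ws) (b ∷ bs) = w b * weight ws bs
  weight _        _        = 1#

  weightSum : List (Bool → Carrier) → Carrier
  weightSum []       = 1#
  weightSum (w ∷ ws) = (w false + w true) * weightSum ws

  Σ-allBools-weight : ∀ ws → Σ R (allBools (length ws)) (weight ws) ≈ weightSum ws
  Σ-allBools-weight []       = +-identityʳ _
  Σ-allBools-weight (w ∷ ws) = begin
    Σ R (allBools (suc (length ws))) (weight (w ∷ ws))
      ≈⟨ Σ-concatMap _ (allBools (length ws)) (weight (w ∷ ws)) ⟩
    Σ R (allBools (length ws)) (λ bs → w false * weight ws bs + (w true * weight ws bs + 0#))
      ≈⟨ Σ-cong (allBools (length ws)) (λ bs → trans (+-congˡ (+-identityʳ _)) (sym (distribʳ _ _ _))) ⟩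
    Σ R (allBools (length ws)) (λ bs → (w false + w true) * weight ws bs)
      ≈⟨ *-Σ _ (allBools (length ws)) (weight ws) ⟨
    (w false + w true) * Σ R (allBools (length ws)) (weight ws)
      ≈⟨ *-congˡ (Σ-allBools-weight ws) ⟩
    weightSum (w ∷ ws)
      ∎

  weight-∷ʳ : ∀ ws bs w b → length ws ≡ length bs → weight (ws ∷ʳ w) (bs ∷ʳ b) ≈ weight ws bs * w b
  weight-∷ʳ []        []        w b _ = trans (*-identityʳ _) (sym (*-identityˡ _))
  weight-∷ʳ (w' ∷ ws) (b' ∷ bs) w b l =
    trans (*-congˡ (weight-∷ʳ ws bs w b (ℕₚ.suc-injective l))) (sym (*-assoc _ _ _))

  weight-reverse : ∀ ws bs → length ws ≡ length bs → weight ws bs ≈ weight (reverse ws) (reverse bs)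
  weight-reverse []       []       _ = ≈-refl
  weight-reverse (w ∷ ws) (b ∷ bs) l = begin
    w b * weight ws bs                              ≈⟨ *-comm _ _ ⟩
    weight ws bs * w b                              ≈⟨ *-congʳ (weight-reverse ws bs l') ⟩
    weight (reverse ws) (reverse bs) * w b          ≈⟨ weight-∷ʳ (reverse ws) (reverse bs) w b
                                                         (≡.trans (length-reverse ws) (≡.trans l' (≡.sym (length-reverse bs)))) ⟨
    weight (reverse ws ∷ʳ w) (reverse bs ∷ʳ b)      ≡⟨ cong₂ weight (unfold-reverse w ws) (unfold-reverse b bs) ⟨
    weight (reverse (w ∷ ws)) (reverse (b ∷ bs))    ∎
    where l' = ℕₚ.suc-injective l

  Σ-allBools-==ᴮ : ∀ k (w : List Bool → Carrier) D →
    Σ R (allBools k) (λ b → w b * δ R (D ==ᴮ b)) ≈ δ R (length D ≡ᵇ k) * w D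
  Σ-allBools-==ᴮ zero    w []      = trans (+-identityʳ _) (trans (*-identityʳ _) (sym (*-identityˡ _)))
  Σ-allBools-==ᴮ zero    w (x ∷ D) = trans (+-identityʳ _) (trans (zeroʳ _) (sym (zeroˡ _)))
  Σ-allBools-==ᴮ (suc k) w []      = begin
    Σ R (concatMap _ (allBools k)) (λ b → w b * δ R ([] ==ᴮ b))   ≈⟨ Σ-concatMap _ (allBools k) _ ⟩
    Σ R (allBools k) (λ bs → w (false ∷ bs) * 0# + (w (true ∷ bs) * 0# + 0#))
      ≈⟨ Σ-zero (allBools k) (λ bs → trans (+-cong (zeroʳ _) (+-congʳ (zeroʳ _)))
                                      (trans (+-identityˡ _) (+-identityˡ _))) ⟩
    0#                                                             ≈⟨ zeroˡ _ ⟨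
    0# * w []                                                      ∎
  Σ-allBools-==ᴮ (suc k) w (true ∷ D) =
    trans (Σ-concatMap _ (allBools k) _)
      (trans (Σ-cong (allBools k) (λ bs → trans (+-cong (zeroʳ _) (+-identityʳ _)) (+-identityˡ _)))
        (Σ-allBools-==ᴮ k (w ∘ (true ∷_)) D))
  Σ-allBools-==ᴮ (suc k) w (false ∷ D) =
    trans (Σ-concatMap _ (allBools k) _)
      (trans (Σ-cong (allBools k) (λ bs → trans (+-congˡ (trans (+-congʳ (zeroʳ _)) (+-identityˡ _))) (+-identityʳ _)))
        (Σ-allBools-==ᴮ k (w ∘ (false ∷_)) D))

  -- M_δ = Σ_E (Π_j möbius [j ∈ D(δ)] [j ∈ E]) F_E, by inclusion–exclusion over E ⊇ D(δ).
  möbius : Bool → Bool → Carrier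
  möbius true  true  = 1#
  möbius true  false = 0#
  möbius false false = 1#
  möbius false true  = - 1#

  -- the factor of position j once the constraint [E ⊆ D] is folded in
  guarded : (Bool → Bool → Carrier) → Bool → Bool → Bool → Carrier
  guarded f c d e = f c e * δ R (not e ∨ d)

  weight-⊆ᵇ : ∀ f cs ds E → length cs ≡ length ds → length E ≡ length cs →
    weight (map f cs) E * δ R (E ⊆ᵇ ds) ≈ weight (zipWith (guarded f) cs ds) E
  weight-⊆ᵇ f []        []        []      _  _  = *-identityʳ _
  weight-⊆ᵇ f (c' ∷ cs) (d' ∷ ds) (e ∷ E) l₁ l₂ = begin
    (f c' e * weight (map f cs) E) * δ R ((not e ∨ d') ∧ (E ⊆ᵇ ds))
      ≈⟨ *-congˡ (δ-∧ _ _) ⟩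
    (f c' e * weight (map f cs) E) * (δ R (not e ∨ d') * δ R (E ⊆ᵇ ds))
      ≈⟨ *-assoc _ _ _ ⟩
    f c' e * (weight (map f cs) E * (δ R (not e ∨ d') * δ R (E ⊆ᵇ ds)))
      ≈⟨ *-congˡ (x∙yz≈y∙xz _ _ _) ⟩
    f c' e * (δ R (not e ∨ d') * (weight (map f cs) E * δ R (E ⊆ᵇ ds)))
      ≈⟨ *-assoc _ _ _ ⟨
    guarded f c' d' e * (weight (map f cs) E * δ R (E ⊆ᵇ ds))
      ≈⟨ *-congˡ (weight-⊆ᵇ f cs ds E (ℕₚ.suc-injective l₁) (ℕₚ.suc-injective l₂)) ⟩
    weight (zipWith (guarded f) (c' ∷ cs) (d' ∷ ds)) (e ∷ E)
      ∎

  Σ-allBools-weight-⊆ᵇ : ∀ f cs ds → length cs ≡ length ds →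
    Σ R (allBools (length cs)) (λ E → weight (map f cs) E * δ R (E ⊆ᵇ ds)) ≈ weightSum (zipWith (guarded f) cs ds)
  Σ-allBools-weight-⊆ᵇ f cs ds l = begin
    Σ R (allBools (length cs)) (λ E → weight (map f cs) E * δ R (E ⊆ᵇ ds))
      ≈⟨ Σ-congᴬ (allBools-length (length cs)) (λ E lE → weight-⊆ᵇ f cs ds E l lE) ⟩
    Σ R (allBools (length cs)) (weight ws)
      ≡⟨ cong (λ n → Σ R (allBools n) (weight ws)) (length-zipWith-≡ (guarded f) cs ds l) ⟨
    Σ R (allBools (length ws)) (weight ws)
      ≈⟨ Σ-allBools-weight ws ⟩
    weightSum ws
      ∎
    where ws = zipWith (guarded f) cs ds

  weightSum-möbius : ∀ cs ds → length cs ≡ length ds →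
    weightSum (zipWith (guarded möbius) cs ds) ≈ δ R (cs ==ᴮ ds)
  weightSum-möbius []        []        _ = ≈-refl
  weightSum-möbius (c' ∷ cs) (d' ∷ ds) l =
    trans (*-cong (column c' d') (weightSum-möbius cs ds (ℕₚ.suc-injective l))) (sym (δ-∧ _ _))
    where
    column : ∀ c' d' → guarded möbius c' d' false + guarded möbius c' d' true ≈ δ R (does (c' ≟ᴮ d'))
    column true  true  = trans (+-cong (zeroˡ _) (*-identityˡ _)) (+-identityˡ _)
    column true  false = trans (+-cong (zeroˡ _) (*-identityˡ _)) (+-identityˡ _)
    column false true  = trans (+-cong (*-identityˡ _) (*-identityʳ _)) (trans (+-comm _ _) (-‿inverseˡ 1#))
    column false false = trans (+-cong (*-identityˡ _) (zeroʳ _)) (+-identityʳ _)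

  -- the coefficients after ω, which complements every descent indicator
  möbiusᶜ : Bool → Bool → Carrier
  möbiusᶜ c e = möbius c (not e)

  weight-map-not : ∀ cs ys → weight (map möbius cs) (map not ys) ≡ weight (map möbiusᶜ cs) ys
  weight-map-not []       []       = refl
  weight-map-not []       (y ∷ ys) = refl
  weight-map-not (x ∷ cs) []       = refl
  weight-map-not (x ∷ cs) (y ∷ ys) = cong (möbius x (not y) *_) (weight-map-not cs ys)

  weight-map-reverseʳ : ∀ (f : Bool → Bool → Carrier) xs ys → length xs ≡ length ys →
    weight (map f xs) (reverse ys) ≈ weight (map f (reverse xs)) ys
  weight-map-reverseʳ f xs ys l = begin
    weight (map f xs) (reverse ys)                      ≈⟨ weight-reverse (map f xs) (reverse ys) l' ⟩
    weight (reverse (map f xs)) (reverse (reverse ys))  ≡⟨ cong₂ weight (reverse-map f xs) (≡.sym (reverse-involutive ys)) ⟨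
    weight (map f (reverse xs)) ys                      ∎
    where l' = ≡.trans (length-map f xs) (≡.trans l (≡.sym (length-reverse ys)))

  weightSum-möbiusᶜ : ∀ cs ds → length cs ≡ length ds →
    weightSum (zipWith (guarded möbiusᶜ) cs ds) ≈ sgn R (countFalse cs) * δ R (ds ⊆ᵇ cs)
  weightSum-möbiusᶜ []        []        _ = sym (*-identityˡ _)
  weightSum-möbiusᶜ (true ∷ cs) (d' ∷ ds) l =
    trans (*-cong (column d') (weightSum-möbiusᶜ cs ds (ℕₚ.suc-injective l))) (trans (*-identityˡ _) (*-congˡ (lemma d')))
    where
    column : ∀ d' → guarded möbiusᶜ true d' false + guarded möbiusᶜ true d' true ≈ 1#
    column d' = trans (+-cong (*-identityˡ _) (zeroˡ _)) (+-identityʳ _)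
    lemma : ∀ d' → δ R (ds ⊆ᵇ cs) ≈ δ R ((not d' ∨ true) ∧ (ds ⊆ᵇ cs))
    lemma true  = ≈-refl
    lemma false = ≈-refl
  weightSum-möbiusᶜ (false ∷ cs) (d' ∷ ds) l = begin
    (guarded möbiusᶜ false d' false + guarded möbiusᶜ false d' true) * weightSum (zipWith (guarded möbiusᶜ) cs ds)
      ≈⟨ *-cong (column d') (weightSum-möbiusᶜ cs ds (ℕₚ.suc-injective l)) ⟩
    - δ R (not d') * (sgn R (countFalse cs) * δ R (ds ⊆ᵇ cs))
      ≈⟨ -‿*-comm _ _ ⟩
    - (δ R (not d') * (sgn R (countFalse cs) * δ R (ds ⊆ᵇ cs)))
      ≈⟨ -‿cong (x∙yz≈y∙xz _ _ _) ⟩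
    - (sgn R (countFalse cs) * (δ R (not d') * δ R (ds ⊆ᵇ cs)))
      ≈⟨ -‿*-comm _ _ ⟨
    sgn R (suc (countFalse cs)) * (δ R (not d') * δ R (ds ⊆ᵇ cs))
      ≈⟨ *-congˡ (trans (*-congʳ (lemma d')) (sym (δ-∧ _ _))) ⟩
    sgn R (suc (countFalse cs)) * δ R ((not d' ∨ false) ∧ (ds ⊆ᵇ cs))
      ∎
    where
    column : ∀ d' → guarded möbiusᶜ false d' false + guarded möbiusᶜ false d' true ≈ - δ R (not d')
    column true  = trans (+-cong (*-identityʳ _) (*-identityˡ _)) (trans (+-comm _ _) (trans (-‿inverseʳ 1#) (sym ε⁻¹≈ε)))
    column false = trans (+-cong (*-identityʳ _) (*-identityˡ _)) (+-identityʳ _)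
    lemma : ∀ d' → δ R (not d') ≈ δ R (not d' ∨ false)
    lemma true  = ≈-refl
    lemma false = ≈-refl

  Σ-möbius-⊆ᵇ : ∀ cs ds → length cs ≡ length ds →
    Σ R (allBools (length cs)) (λ E → weight (map möbius cs) E * δ R (E ⊆ᵇ ds)) ≈ δ R (ds ==ᴮ cs)
  Σ-möbius-⊆ᵇ cs ds l = begin
    Σ R (allBools (length cs)) (λ E → weight (map möbius cs) E * δ R (E ⊆ᵇ ds))  ≈⟨ Σ-allBools-weight-⊆ᵇ möbius cs ds l ⟩
    weightSum (zipWith (guarded möbius) cs ds)                                  ≈⟨ weightSum-möbius cs ds l ⟩
    δ R (cs ==ᴮ ds)                                                             ≡⟨ cong (δ R) (==ᴮ-sym cs ds) ⟩
    δ R (ds ==ᴮ cs)                                                             ∎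

  Σ-möbiusᶜ-⊆ᵇ : ∀ cs ds → length cs ≤ length ds →
    Σ R (allBools (length cs)) (λ E → weight (map möbiusᶜ cs) E * δ R (E ⊆ᵇ ds)) ≈
    sgn R (countFalse cs) * δ R (ds ⊆ᵇ cs)
  Σ-möbiusᶜ-⊆ᵇ cs ds cs≤ds = begin
    Σ R (allBools k) (λ E → weight (map möbiusᶜ cs) E * δ R (E ⊆ᵇ ds))
      ≈⟨ Σ-congᴬ (allBools-length k) (λ E lE → *-congˡ (reflexive (cong (δ R)
           (≡.trans (⊆ᵇ-takeʳ E ds) (cong (λ z → E ⊆ᵇ take z ds) lE))))) ⟩
    Σ R (allBools k) (λ E → weight (map möbiusᶜ cs) E * δ R (E ⊆ᵇ ds'))
      ≈⟨ Σ-allBools-weight-⊆ᵇ möbiusᶜ cs ds' l ⟩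
    weightSum (zipWith (guarded möbiusᶜ) cs ds')
      ≈⟨ weightSum-möbiusᶜ cs ds' l ⟩
    sgn R (countFalse cs) * δ R (ds' ⊆ᵇ cs)
      ≡⟨ cong (λ z → sgn R (countFalse cs) * δ R z) (⊆ᵇ-takeˡ ds cs) ⟨
    sgn R (countFalse cs) * δ R (ds ⊆ᵇ cs)
      ∎
    where
    k   = length cs
    ds' = take k ds
    l : k ≡ length ds'
    l = ≡.sym (≡.trans (length-take k ds) (ℕₚ.m≤n⇒m⊓n≡m cs≤ds))

  ⟦⟧-concatMap : ∀ {a} {A : Set a} (h : A → QS R) xs p →
    ⟦_⟧ R (concatMap h xs) p ≈ Σ R xs (λ x → ⟦_⟧ R (h x) p)
  ⟦⟧-concatMap h xs p = Σ-concatMap h xs _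

  ⟦⟧-scale : ∀ a (f : QS R) p → ⟦_⟧ R (scale R a f) p ≈ a * ⟦_⟧ R f p
  ⟦⟧-scale a []            p = sym (zeroʳ a)
  ⟦⟧-scale a ((b , α) ∷ f) p = trans (+-cong (*-assoc a b _) (⟦⟧-scale a f p)) (sym (distribˡ a _ _))

  FPS-fromBools : ∀ E p →
    FPS R (fromBools E) p ≈ δ R (size (flat p) ≡ᵇ suc (length E)) * δ R (E ⊆ᵇ toBools (flat p))
  FPS-fromBools E p = trans (reflexive (cong (δ R) (≡.trans (FCond-flat (fromBools E) p)
    (cong₂ (λ u v → (size (flat p) ≡ᵇ u) ∧ (v ⊆ᵇ toBools (flat p))) (size-fromBools E) (toBools-fromBools E)))))
    (δ-∧ _ _)

  δ-size-length : ∀ φ k x →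
    δ R (size φ ≡ᵇ suc k) * (δ R (length (toBools φ) ≡ᵇ k) * x) ≈ δ R (size φ ≡ᵇ suc k) * x
  δ-size-length []      k x = trans (zeroˡ _) (sym (zeroˡ _))
  δ-size-length (a ∷ φ) k x =
    trans (*-congˡ (*-congʳ (reflexive (cong (λ z → δ R (z ≡ᵇ suc k)) (suc-length-toBools a φ))))) (δ-idem _ x)

  -- F_E = Σ_{b ⊇ E} M_b
  FQS : List Bool → QS R
  FQS E = map (λ b → (δ R (E ⊆ᵇ b) , fromBools b)) (allBools (length E))

  ⟦FQS⟧ : ∀ E p → ⟦_⟧ R (FQS E) p ≈ FPS R (fromBools E) p
  ⟦FQS⟧ E p = begin
    ⟦_⟧ R (FQS E) p
      ≡⟨ Σ-map _ (allBools n) _ ⟩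
    Σ R (allBools n) (λ b → δ R (E ⊆ᵇ b) * δ R (flat p == fromBools b))
      ≈⟨ Σ-congᴬ (allBools-length n) (λ b lb → *-congˡ (trans (reflexive (cong (δ R)
           (≡.trans (==-fromBools (flat p) b) (cong (λ z → (size (flat p) ≡ᵇ suc z) ∧ (D ==ᴮ b)) lb)))) (δ-∧ _ _))) ⟩
    Σ R (allBools n) (λ b → δ R (E ⊆ᵇ b) * (δ R S * δ R (D ==ᴮ b)))
      ≈⟨ Σ-cong (allBools n) (λ b → x∙yz≈y∙xz _ _ _) ⟩
    Σ R (allBools n) (λ b → δ R S * (δ R (E ⊆ᵇ b) * δ R (D ==ᴮ b)))
      ≈⟨ *-Σ _ (allBools n) _ ⟨
    δ R S * Σ R (allBools n) (λ b → δ R (E ⊆ᵇ b) * δ R (D ==ᴮ b))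
      ≈⟨ *-congˡ (Σ-allBools-==ᴮ n (λ b → δ R (E ⊆ᵇ b)) D) ⟩
    δ R S * (δ R (length D ≡ᵇ n) * δ R (E ⊆ᵇ D))
      ≈⟨ δ-size-length (flat p) n _ ⟩
    δ R S * δ R (E ⊆ᵇ D)
      ≈⟨ FPS-fromBools E p ⟨
    FPS R (fromBools E) p
      ∎
    where
    n = length E
    D = toBools (flat p)
    S = size (flat p) ≡ᵇ suc n

  -- M_δ in the F basis, for δ with descent word cs
  MQS : List Bool → QS R
  MQS cs = concatMap (λ E → scale R (weight (map möbius cs) E) (FQS E)) (allBools (length cs))

  ⟦MQS⟧ : ∀ a η p → ⟦_⟧ R (MQS (toBools (a ∷ η))) p ≈ MPS R (a ∷ η) p
  ⟦MQS⟧ a η p = begin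
    ⟦_⟧ R (MQS cs) p
      ≈⟨ ⟦⟧-concatMap _ (allBools n) p ⟩
    Σ R (allBools n) (λ E → ⟦_⟧ R (scale R (weight (map möbius cs) E) (FQS E)) p)
      ≈⟨ Σ-congᴬ (allBools-length n) (λ E lE → trans (⟦⟧-scale _ (FQS E) p) (*-congˡ (trans (⟦FQS⟧ E p)
           (trans (FPS-fromBools E p) (reflexive (cong (λ z → δ R (size φ ≡ᵇ suc z) * δ R (E ⊆ᵇ D)) lE)))))) ⟩
    Σ R (allBools n) (λ E → weight (map möbius cs) E * (δ R S * δ R (E ⊆ᵇ D)))
      ≈⟨ Σ-cong (allBools n) (λ E → x∙yz≈y∙xz _ _ _) ⟩
    Σ R (allBools n) (λ E → δ R S * (weight (map möbius cs) E * δ R (E ⊆ᵇ D)))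
      ≈⟨ *-Σ _ (allBools n) _ ⟨
    δ R S * Σ R (allBools n) (λ E → weight (map möbius cs) E * δ R (E ⊆ᵇ D))
      ≈⟨ δ-guard S (λ h → Σ-möbius-⊆ᵇ cs D (≡.sym (length-toBools φ (≡ᵇ≡true⇒≡ h)))) ⟩
    δ R S * δ R (D ==ᴮ cs)
      ≈⟨ δ-∧ _ _ ⟨
    δ R (S ∧ (D ==ᴮ cs))
      ≡⟨ cong (δ R) (==-fromBools φ cs) ⟨
    δ R (φ == fromBools cs)
      ≡⟨ cong (λ z → δ R (φ == z)) (fromBools-toBools a η) ⟩
    MPS R (a ∷ η) p
      ∎
    where
    cs = toBools (a ∷ η)
    n  = length cs
    φ  = flat p
    D  = toBools φ
    S  = size φ ≡ᵇ suc n

  mulPS-cong : ∀ {A A' B B' : PS R} p → (∀ x → A x ≈ A' x) → (∀ y → B y ≈ B' y) →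
    mulPS R A B p ≈ mulPS R A' B' p
  mulPS-cong p hA hB = Σ-cong (splits p) (λ { (x , y) → *-cong (hA x) (hB y) })

  mulPS-*ˡ : ∀ s (A B : PS R) p → mulPS R (λ x → s * A x) B p ≈ s * mulPS R A B p
  mulPS-*ˡ s A B p = trans (Σ-cong (splits p) (λ { (x , y) → *-assoc s (A x) (B y) })) (sym (*-Σ s (splits p) _))

  mulPS-*ʳ : ∀ s (A B : PS R) p → mulPS R A (λ y → s * B y) p ≈ s * mulPS R A B p
  mulPS-*ʳ s A B p = trans (Σ-cong (splits p) (λ { (x , y) → x∙yz≈y∙xz (A x) s (B y) })) (sym (*-Σ s (splits p) _))

  mulPS-zeroʳ : ∀ (A B : PS R) p → (∀ y → B y ≈ 0#) → mulPS R A B p ≈ 0#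
  mulPS-zeroʳ A B p h = Σ-zero (splits p) (λ { (x , y) → trans (*-congˡ (h y)) (zeroʳ _) })

  mulPS-Σʳ : ∀ {b} {X : Set b} (xs : List X) (A : PS R) (B : X → PS R) p →
    mulPS R A (λ y → Σ R xs (λ x → B x y)) p ≈ Σ R xs (λ x → mulPS R A (B x) p)
  mulPS-Σʳ xs A B p = trans (Σ-cong (splits p) (λ { (u , v) → *-Σ (A u) xs (λ x → B x v) }))
    (Σ-comm (splits p) xs (λ { (u , v) x → A u * B x v }))

  mulPS-Σˡ : ∀ {b} {X : Set b} (xs : List X) (A : X → PS R) (B : PS R) p →
    mulPS R (λ u → Σ R xs (λ x → A x u)) B p ≈ Σ R xs (λ x → mulPS R (A x) B p)
  mulPS-Σˡ xs A B p = trans (Σ-cong (splits p) (λ { (u , v) → Σ-* (B v) xs (λ x → A x u) }))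
    (Σ-comm (splits p) xs (λ { (u , v) x → A x u * B v }))

  Σ-splits-∷ : ∀ (g : Mono × Mono → Carrier) e p →
    Σ R (splits (e ∷ p)) g ≈ Σ R (upTo (suc e)) (λ k → Σ R (splits p) (λ { (x , y) → g (k ∷ x , (e ∸ k) ∷ y) }))
  Σ-splits-∷ g e p = trans (Σ-concatMap (λ k → map (shift k) (splits p)) (upTo (suc e)) g)
    (Σ-cong (upTo (suc e)) (λ k → reflexive (Σ-map (shift k) (splits p) g)))
    where
    shift : ℕ → Mono × Mono → Mono × Mono
    shift k (x , y) = k ∷ x , (e ∸ k) ∷ y

  mulPS-∷ : ∀ (A B : PS R) e p →
    mulPS R A B (e ∷ p) ≈ Σ R (upTo (suc e)) (λ k → mulPS R (A ∘ (k ∷_)) (B ∘ ((e ∸ k) ∷_)) p)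
  mulPS-∷ A B = Σ-splits-∷ (λ { (x , y) → A x * B y })

  mulPS-suc∷ : ∀ (A B : PS R) e' p → mulPS R A B (suc e' ∷ p) ≈
    mulPS R (A ∘ (suc e' ∷_)) (B ∘ (0 ∷_)) p + Σ R (upTo (suc e')) (λ k → mulPS R (A ∘ (k ∷_)) (B ∘ ((suc e' ∸ k) ∷_)) p)
  mulPS-suc∷ A B e' p = begin
    mulPS R A B (suc e' ∷ p)                  ≈⟨ mulPS-∷ A B (suc e') p ⟩
    Σ R (upTo (suc (suc e'))) term            ≈⟨ Σ-upTo-∷ʳ (suc e') term ⟩
    rest + term (suc e')                      ≈⟨ +-comm _ _ ⟩
    term (suc e') + rest                      ≡⟨ cong (λ z → mulPS R (A ∘ (suc e' ∷_)) (B ∘ (z ∷_)) p + rest) (ℕₚ.n∸n≡0 e') ⟩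
    mulPS R (A ∘ (suc e' ∷_)) (B ∘ (0 ∷_)) p + rest  ∎
    where
    term : ℕ → Carrier
    term k = mulPS R (A ∘ (k ∷_)) (B ∘ ((suc e' ∸ k) ∷_)) p
    rest = Σ R (upTo (suc e')) term

  precPS-∷ : ∀ (A B : PS R) e p → precPS R A B (e ∷ p) ≈
    Σ R (upTo (suc e)) (λ k → Σ R (splits p) (λ { (x , y) →
      δ R (minLt (k ∷ x) ((e ∸ k) ∷ y)) * A (k ∷ x) * B ((e ∸ k) ∷ y) }))
  precPS-∷ A B = Σ-splits-∷ (λ { (x , y) → δ R (minLt x y) * A x * B y })

  precPS-⟦⟧ʳ : ∀ (A : PS R) f p → precPS R A (⟦_⟧ R f) p ≈ Σ R f (λ { (a , γ) → a * precPS R A (MPS R γ) p })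
  precPS-⟦⟧ʳ A f p = begin
    precPS R A (⟦_⟧ R f) p
      ≈⟨ Σ-cong (splits p) (λ { (x , y) → trans (*-Σ _ f _) (Σ-cong f (λ { (a , γ) → x∙yz≈y∙xz _ a _ })) }) ⟩
    Σ R (splits p) (λ { (x , y) → Σ R f (λ { (a , γ) → a * (δ R (minLt x y) * A x * MPS R γ y) }) })
      ≈⟨ Σ-comm (splits p) f _ ⟩
    Σ R f (λ { (a , γ) → Σ R (splits p) (λ { (x , y) → a * (δ R (minLt x y) * A x * MPS R γ y) }) })
      ≈⟨ Σ-cong f (λ { (a , γ) → sym (trans (*-Σ a (splits p) _) (Σ-cong (splits p) (λ { (x , y) → ≈-refl }))) }) ⟩
    Σ R f (λ { (a , γ) → a * precPS R A (MPS R γ) p })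
      ∎

  withinPS : ℕ → Comp → PS R
  withinPS m β u = δ R (within m β (flat u))

  splitTerm : ℕ → Comp → ℕ → PS R
  splitTerm m γ i = mulPS R (withinPS m (reverse (take i γ))) (MPS R (drop i γ))

  -- x₁ cannot occur in the right factor of ≺ unless it occurs in the left one.
  precPS-h-M-suc∷ : ∀ m γ e' p →
    precPS R (hPS R m) (MPS R γ) (suc e' ∷ p) ≈ mulPS R (withinPS m [] ∘ (suc e' ∷_)) (MPS R γ) p
  precPS-h-M-suc∷ m γ e' p = begin
    precPS R (hPS R m) (MPS R γ) (e ∷ p)
      ≈⟨ precPS-∷ _ _ e p ⟩
    Σ R (upTo (suc e)) (λ k → Σ R (splits p) (term k))
      ≈⟨ Σ-upTo-∷ʳ e _ ⟩
    Σ R (upTo e) (λ k → Σ R (splits p) (term k)) + Σ R (splits p) (term e)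
      ≈⟨ +-congʳ (trans (Σ-congᴬ (upTo-< e) (λ k k<e → Σ-zero (splits p) (λ { (x , y) → x₁-right k<e x y })))
                        (Σ-zero (upTo e) (λ _ → ≈-refl))) ⟩
    0# + Σ R (splits p) (term e)
      ≈⟨ +-identityˡ _ ⟩
    Σ R (splits p) (term e)
      ≈⟨ Σ-cong (splits p) (λ { (x , y) → x₁-left x y }) ⟩
    mulPS R (withinPS m [] ∘ (e ∷_)) (MPS R γ) p
      ∎
    where
    e = suc e'
    term : ℕ → Mono × Mono → Carrier
    term k (x , y) = δ R (minLt (k ∷ x) ((e ∸ k) ∷ y)) * hPS R m (k ∷ x) * MPS R γ ((e ∸ k) ∷ y)
    x₁-right : ∀ {k} → k < e → ∀ x y → term k (x , y) ≈ 0#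
    x₁-right {k} k<e x y = begin
      δ R (minLt (k ∷ x) ((e ∸ k) ∷ y)) * hPS R m (k ∷ x) * MPS R γ ((e ∸ k) ∷ y)
        ≡⟨ cong (λ z → δ R (minLt (k ∷ x) (z ∷ y)) * hPS R m (k ∷ x) * MPS R γ (z ∷ y)) (ℕₚ.+-∸-assoc 1 (ℕₚ.≤-pred k<e)) ⟩
      δ R (minLt (k ∷ x) (suc (e' ∸ k) ∷ y)) * hPS R m (k ∷ x) * MPS R γ (suc (e' ∸ k) ∷ y)
        ≡⟨ cong (λ z → δ R z * hPS R m (k ∷ x) * MPS R γ (suc (e' ∸ k) ∷ y)) (minLt-∷-suc∷ k (e' ∸ k) x y) ⟩
      0# * hPS R m (k ∷ x) * MPS R γ (suc (e' ∸ k) ∷ y)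
        ≈⟨ trans (*-congʳ (zeroˡ _)) (zeroˡ _) ⟩
      0#
        ∎
    x₁-left : ∀ x y → term e (x , y) ≈ withinPS m [] (e ∷ x) * MPS R γ y
    x₁-left x y = begin
      δ R (minLt (e ∷ x) ((e ∸ e) ∷ y)) * hPS R m (e ∷ x) * MPS R γ ((e ∸ e) ∷ y)
        ≡⟨ cong (λ z → δ R (minLt (e ∷ x) (z ∷ y)) * hPS R m (e ∷ x) * MPS R γ (z ∷ y)) (ℕₚ.n∸n≡0 e') ⟩
      δ R (minLt (e ∷ x) (0 ∷ y)) * hPS R m (e ∷ x) * MPS R γ y
        ≡⟨ cong (λ z → δ R z * hPS R m (e ∷ x) * MPS R γ y) (minLt-suc∷-0∷ e' x y) ⟩
      1# * hPS R m (e ∷ x) * MPS R γ y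
        ≈⟨ *-congʳ (trans (*-identityˡ _) (reflexive (cong (δ R) (≡.trans (cong (_≡ᵇ m) (degree-flat (e ∷ x)))
                                                                       (≡.sym (within-[]ˡ m (flat (e ∷ x)))))))) ⟩
      withinPS m [] (e ∷ x) * MPS R γ y
        ∎

  MPS-∷-∸ : ∀ c' γ' {e' k} → k ≤ e' → ∀ y →
    MPS R (c' ∷ γ') ((suc e' ∸ k) ∷ y) ≈ (δ R (k ≡ᵇ e' ∸ c') * δ R (not (e' <ᵇ c'))) * MPS R γ' y
  MPS-∷-∸ c' γ' {e'} {k} k≤e' y = begin
    δ R (flat ((suc e' ∸ k) ∷ y) == (c' ∷ γ'))
      ≡⟨ cong (λ z → δ R (flat (z ∷ y) == (c' ∷ γ'))) (ℕₚ.+-∸-assoc 1 k≤e') ⟩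
    δ R ((e' ∸ k ≡ᵇ c') ∧ (flat y == γ'))
      ≡⟨ cong (λ z → δ R (z ∧ (flat y == γ'))) (∸≡ᵇ-swap k≤e') ⟩
    δ R (((k ≡ᵇ e' ∸ c') ∧ not (e' <ᵇ c')) ∧ (flat y == γ'))
      ≈⟨ trans (δ-∧ _ _) (*-congʳ (δ-∧ _ _)) ⟩
    (δ R (k ≡ᵇ e' ∸ c') * δ R (not (e' <ᵇ c'))) * MPS R γ' y
      ∎

  withinPS-∷ : ∀ m c' β e' x →
    withinPS m (c' ∷ β) (suc e' ∷ x) ≈ δ R (not (e' <ᵇ c')) * withinPS m β ((e' ∸ c') ∷ x)
  withinPS-∷ m c' β e' x = begin
    δ R (within m (c' ∷ β) (e' ∷ flat x))
      ≡⟨ cong (δ R) (within-∷ m c' β e' (flat x)) ⟩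
    δ R (if e' <ᵇ c' then false else within m β (prependPart (e' ∸ c') (flat x)))
      ≈⟨ δ-if _ _ ⟩
    δ R (not (e' <ᵇ c')) * δ R (within m β (prependPart (e' ∸ c') (flat x)))
      ≡⟨ cong (λ z → δ R (not (e' <ᵇ c')) * δ R (within m β z)) (flat-∷ (e' ∸ c') x) ⟨
    δ R (not (e' <ᵇ c')) * withinPS m β ((e' ∸ c') ∷ x)
      ∎

  -- When x₁ is shared, the first part c' of drop i γ must be exactly the
  -- x₁-part of the right factor, which moves c' into the G-factor.
  splitTerm-x₁-shared : ∀ m γ e' p i → i < length γ →
    Σ R (upTo (suc e')) (λ k → mulPS R (withinPS m (reverse (take i γ)) ∘ (k ∷_)) (MPS R (drop i γ) ∘ ((suc e' ∸ k) ∷_)) p)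
    ≈ mulPS R (withinPS m (reverse (take (suc i) γ)) ∘ (suc e' ∷_)) (MPS R (drop (suc i) γ)) p
  splitTerm-x₁-shared m γ e' p i i<ℓ with drop i γ in drop≡ | drop-nonempty i γ i<ℓ
  ... | .(c' ∷ γ') | c' , γ' , refl = begin
    Σ R (upTo e) (λ k → mulPS R (G ∘ (k ∷_)) (MPS R (c' ∷ γ') ∘ ((e ∸ k) ∷_)) p)
      ≈⟨ Σ-congᴬ (upTo-< e) (λ k k<e → mulPS-cong p (λ _ → ≈-refl) (MPS-∷-∸ c' γ' (ℕₚ.≤-pred k<e))) ⟩
    Σ R (upTo e) (λ k → mulPS R (G ∘ (k ∷_)) (λ y → (δ R (k ≡ᵇ j) * δ R ok) * MPS R γ' y) p)
      ≈⟨ Σ-cong (upTo e) (λ k → trans (mulPS-*ʳ _ _ _ p) (*-assoc _ _ _)) ⟩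
    Σ R (upTo e) (λ k → δ R (k ≡ᵇ j) * (δ R ok * mulPS R (G ∘ (k ∷_)) (MPS R γ') p))
      ≈⟨ Σ-upTo-δ e j _ ⟩
    δ R (j <ᵇ e) * (δ R ok * mulPS R (G ∘ (j ∷_)) (MPS R γ') p)
      ≈⟨ trans (*-congʳ (reflexive (cong (δ R) (<⇒<ᵇ≡true (s≤s (ℕₚ.m∸n≤m e' c')))))) (*-identityˡ _) ⟩
    δ R ok * mulPS R (G ∘ (j ∷_)) (MPS R γ') p
      ≈⟨ mulPS-*ˡ _ _ _ p ⟨
    mulPS R (λ x → δ R ok * G (j ∷ x)) (MPS R γ') p
      ≈⟨ mulPS-cong p (λ x → sym (withinPS-∷ m c' (reverse (take i γ)) e' x)) (λ _ → ≈-refl) ⟩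
    mulPS R (withinPS m (c' ∷ reverse (take i γ)) ∘ (e ∷_)) (MPS R γ') p
      ≡⟨ cong₂ (λ β ν → mulPS R (withinPS m β ∘ (e ∷_)) (MPS R ν) p)
               (reverse-take-suc-∷ i γ drop≡) (drop-suc-∷ i γ drop≡) ⟨
    mulPS R (withinPS m (reverse (take (suc i) γ)) ∘ (e ∷_)) (MPS R (drop (suc i) γ)) p
      ∎
    where
    e  = suc e'
    j  = e' ∸ c'
    ok = not (e' <ᵇ c')
    G  = withinPS m (reverse (take i γ))

  splitTerm-x₁-shared-last : ∀ m γ e' p →
    Σ R (upTo (suc e')) (λ k → mulPS R (withinPS m (reverse (take (length γ) γ)) ∘ (k ∷_))
                                       (MPS R (drop (length γ) γ) ∘ ((suc e' ∸ k) ∷_)) p) ≈ 0#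
  splitTerm-x₁-shared-last m γ e' p =
    trans (Σ-congᴬ (upTo-< (suc e')) (λ k k<e → mulPS-zeroʳ _ _ p (λ y → reflexive
            (≡.trans (cong₂ (λ u v → δ R (flat (u ∷ y) == v)) (ℕₚ.+-∸-assoc 1 (ℕₚ.≤-pred k<e)) (drop-all (length γ) γ ℕₚ.≤-refl))
                     (cong (δ R) (==-≢ {e' ∸ k ∷ flat y} {[]} (λ ())))))))
          (Σ-zero (upTo (suc e')) (λ _ → ≈-refl))

  precPS-h-M : ∀ m' γ p → precPS R (hPS R (suc m')) (MPS R γ) p ≈
    Σ R (upTo (suc (length γ))) (λ i → sgn R i * splitTerm (suc m') γ i p)
  precPS-h-M m' γ [] =
    trans (trans (+-identityʳ _) (trans (*-congʳ (zeroˡ _)) (zeroˡ _)))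
          (sym (Σ-zero (upTo (suc (length γ))) (λ i → trans (*-congˡ (G-vanishes i)) (zeroʳ _))))
    where
    G-vanishes : ∀ i → splitTerm (suc m') γ i [] ≈ 0#
    G-vanishes i = trans (+-identityʳ _)
      (trans (*-congʳ (reflexive (cong (δ R) (within-[]ʳ m' (reverse (take i γ)))))) (zeroˡ _))
  precPS-h-M m' γ (zero ∷ p) = begin
    precPS R (hPS R m) (MPS R γ) (0 ∷ p)
      ≈⟨ trans (precPS-∷ _ _ 0 p) (+-identityʳ _) ⟩
    Σ R (splits p) (λ { (x , y) → δ R (minLt (0 ∷ x) (0 ∷ y)) * hPS R m x * MPS R γ y })
      ≈⟨ Σ-cong (splits p) (λ { (x , y) → reflexive (cong (λ z → δ R z * hPS R m x * MPS R γ y) (minLt-0∷0∷ x y)) }) ⟩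
    precPS R (hPS R m) (MPS R γ) p
      ≈⟨ precPS-h-M m' γ p ⟩
    Σ R (upTo (suc (length γ))) (λ i → sgn R i * splitTerm m γ i p)
      ≈⟨ Σ-cong (upTo (suc (length γ))) (λ i → *-congˡ (sym (trans (mulPS-∷ _ _ 0 p) (+-identityʳ _)))) ⟩
    Σ R (upTo (suc (length γ))) (λ i → sgn R i * splitTerm m γ i (0 ∷ p))
      ∎
    where m = suc m'
  precPS-h-M m' γ (suc e' ∷ p) = begin
    precPS R (hPS R m) (MPS R γ) (suc e' ∷ p)
      ≈⟨ precPS-h-M-suc∷ m γ e' p ⟩
    x₁-left 0
      ≈⟨ Σ-alternating-telescope (length γ) x₁-left x₁-shared
           (λ i i<ℓ → splitTerm-x₁-shared m γ e' p i i<ℓ) (splitTerm-x₁-shared-last m γ e' p) ⟨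
    Σ R (upTo (suc (length γ))) (λ i → sgn R i * (x₁-left i + x₁-shared i))
      ≈⟨ Σ-cong (upTo (suc (length γ))) (λ i → *-congˡ (sym (mulPS-suc∷ _ _ e' p))) ⟩
    Σ R (upTo (suc (length γ))) (λ i → sgn R i * splitTerm m γ i (suc e' ∷ p))
      ∎
    where
    m = suc m'
    x₁-left : ℕ → Carrier
    x₁-left i = mulPS R (withinPS m (reverse (take i γ)) ∘ (suc e' ∷_)) (MPS R (drop i γ) ∘ (0 ∷_)) p
    x₁-shared : ℕ → Carrier
    x₁-shared i = Σ R (upTo (suc e')) (λ k →
      mulPS R (withinPS m (reverse (take i γ)) ∘ (k ∷_)) (MPS R (drop i γ) ∘ ((suc e' ∸ k) ∷_)) p)

  maxSize : QS R → ℕ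
  maxSize []            = 0
  maxSize ((a , γ) ∷ f) = size γ Nat.⊔ maxSize f

  size<suc-maxSize : ∀ f → All (λ x → size (proj₂ x) < suc (maxSize f)) f
  size<suc-maxSize []            = []
  size<suc-maxSize ((a , γ) ∷ f) =
    s≤s (ℕₚ.m≤m⊔n (size γ) (maxSize f)) ∷ All.map (λ lt → ℕₚ.≤-trans lt (s≤s (ℕₚ.m≤n⊔m (size γ) (maxSize f)))) (size<suc-maxSize f)

  module _ (P : RibbonPairing R) where
    open RibbonPairing P

    pair-[] : ∀ β → pair β [] ≈ 0#
    pair-[] β = x+x≈x⇒x≈0 _ (sym (pair-++ β [] []))

    pair-concatMap : ∀ {a} {A : Set a} β (h : A → QS R) xs →
      pair β (concatMap h xs) ≈ Σ R xs (λ x → pair β (h x))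
    pair-concatMap β h []       = pair-[] β
    pair-concatMap β h (x ∷ xs) = trans (pair-++ β (h x) (concatMap h xs)) (+-congˡ (pair-concatMap β h xs))

    pair-M : ∀ β a η → pair β ((1# , a ∷ η) ∷ []) ≈
      δ R (size β ≡ᵇ size (a ∷ η)) * weight (map möbius (toBools (a ∷ η))) (toBools β)
    pair-M β a η = begin
      pair β ((1# , a ∷ η) ∷ [])
        ≈⟨ pair-resp β _ _ (λ p → trans (+-identityʳ _) (trans (*-identityˡ _) (sym (⟦MQS⟧ a η p)))) ⟩
      pair β (MQS cs)
        ≈⟨ pair-concatMap β _ (allBools n) ⟩
      Σ R (allBools n) (λ E → pair β (scale R (weight (map möbius cs) E) (FQS E)))
        ≈⟨ Σ-congᴬ (allBools-length n) (λ E lE → trans (pair-scal β _ (FQS E)) (*-congˡ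
             (trans (pair-F β (fromBools E) (FQS E) (⟦FQS⟧ E)) (reflexive (cong (δ R)
               (≡.trans (==-sym (fromBools E) β) (≡.trans (==-fromBools β E)
                 (cong (λ z → (size β ≡ᵇ suc z) ∧ (toBools β ==ᴮ E)) lE)))))))) ⟩
      Σ R (allBools n) (λ E → weight (map möbius cs) E * δ R (S ∧ (toBools β ==ᴮ E)))
        ≈⟨ Σ-cong (allBools n) (λ E → trans (*-congˡ (δ-∧ _ _)) (x∙yz≈y∙xz _ _ _)) ⟩
      Σ R (allBools n) (λ E → δ R S * (weight (map möbius cs) E * δ R (toBools β ==ᴮ E)))
        ≈⟨ *-Σ _ (allBools n) _ ⟨
      δ R S * Σ R (allBools n) (λ E → weight (map möbius cs) E * δ R (toBools β ==ᴮ E))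
        ≈⟨ *-congˡ (Σ-allBools-==ᴮ n (weight (map möbius cs)) (toBools β)) ⟩
      δ R S * (δ R (length (toBools β) ≡ᵇ n) * weight (map möbius cs) (toBools β))
        ≈⟨ δ-size-length β n _ ⟩
      δ R S * weight (map möbius cs) (toBools β)
        ≡⟨ cong (λ z → δ R (size β ≡ᵇ z) * weight (map möbius cs) (toBools β)) (suc-length-toBools a η) ⟩
      δ R (size β ≡ᵇ size (a ∷ η)) * weight (map möbius cs) (toBools β)
        ∎
      where
      cs = toBools (a ∷ η)
      n  = length cs
      S  = size β ≡ᵇ suc n

    pair-M[] : ∀ β → pair β ((1# , []) ∷ []) ≈ δ R ([] == β)
    pair-M[] β = pair-F β [] _ (λ p → trans (+-identityʳ _) (trans (*-identityˡ _)
      (reflexive (cong (δ R) (≡.trans (flat==[] (flat p)) (≡.sym (FCond-flat [] p)))))))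
      where
      flat==[] : ∀ φ → (φ == []) ≡ refines [] φ
      flat==[] []      = refl
      flat==[] (a ∷ φ) = refl

    pair-size : ∀ β η → pair β ((1# , η) ∷ []) ≈ δ R (size β ≡ᵇ size η) * pair β ((1# , η) ∷ [])
    pair-size β []      = δ-absorb (size β ≡ᵇ 0)
      (trans (pair-M[] β) (trans (reflexive (cong (δ R) ([]==-size β))) (sym (*-identityʳ _))))
    pair-size β (a ∷ η) = δ-absorb _ (pair-M β a η)

    term : ℕ → Comp → Mono → Comp → Carrier
    term m' η u α = sgn R (size α) * (pair (ω α) ((1# , η) ∷ []) * FPS R (α ⊙ single (suc m')) u)

    term-fromBools : ∀ m' a η u b → length b ≡ length (toBools (a ∷ η)) →
      term m' (a ∷ η) u (fromBools b) ≈
      sgn R (size (a ∷ η)) * (δ R (size (flat u) ≡ᵇ size (a ∷ η) Nat.+ suc m') *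
        (weight (map möbiusᶜ (reverse (toBools (a ∷ η)))) b * δ R (b ⊆ᵇ toBools (flat u))))
    term-fromBools m' a η u b lb
      with fromBools b | fromBoolsAux-nonempty 0 b | toBools-fromBools b | size-fromBools b
    ... | .(c' ∷ cs) | c' , cs , refl | toBools-α | size-α = begin
      sgn R (size α) * (pair (ω α) ((1# , a ∷ η) ∷ []) * FPS R (α ⊙ single (suc m')) u)
        ≈⟨ *-cong (reflexive (cong (sgn R) α≈η)) (*-cong (pair-M (ω α) a η) F-part) ⟩
      sgn R (size (a ∷ η)) * ((δ R (size (ω α) ≡ᵇ size (a ∷ η)) * weight (map möbius cη) (toBools (ω α)))
                              * (δ R S * δ R (b ⊆ᵇ D)))
        ≈⟨ *-congˡ (*-congʳ (trans (*-cong (reflexive (cong (δ R) sizes-agree)) ≈-refl) (*-identityˡ _))) ⟩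
      sgn R (size (a ∷ η)) * (weight (map möbius cη) (toBools (ω α)) * (δ R S * δ R (b ⊆ᵇ D)))
        ≡⟨ cong (λ z → sgn R (size (a ∷ η)) * (weight (map möbius cη) z * (δ R S * δ R (b ⊆ᵇ D))))
             (≡.trans (toBools-ω c' cs) (cong (map not ∘ reverse) toBools-α)) ⟩
      sgn R (size (a ∷ η)) * (weight (map möbius cη) (map not (reverse b)) * (δ R S * δ R (b ⊆ᵇ D)))
        ≈⟨ *-congˡ (*-congʳ (trans (reflexive (weight-map-not cη (reverse b)))
                                   (weight-map-reverseʳ möbiusᶜ cη b (≡.sym lb)))) ⟩
      sgn R (size (a ∷ η)) * (weight (map möbiusᶜ (reverse cη)) b * (δ R S * δ R (b ⊆ᵇ D)))
        ≈⟨ *-congˡ (x∙yz≈y∙xz _ _ _) ⟩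
      sgn R (size (a ∷ η)) * (δ R S * (weight (map möbiusᶜ (reverse cη)) b * δ R (b ⊆ᵇ D)))
        ∎
      where
      α  = c' ∷ cs
      cη = toBools (a ∷ η)
      D  = toBools (flat u)
      S  = size (flat u) ≡ᵇ size (a ∷ η) Nat.+ suc m'
      α≈η : size α ≡ size (a ∷ η)
      α≈η = ≡.trans size-α (≡.trans (cong suc lb) (suc-length-toBools a η))
      sizes-agree : (size (ω α) ≡ᵇ size (a ∷ η)) ≡ true
      sizes-agree = dec-true (size (ω α) ℕₚ.≟ size (a ∷ η)) (≡.trans (size-ω α) α≈η)
      F-part : FPS R (α ⊙ single (suc m')) u ≈ δ R S * δ R (b ⊆ᵇ D)
      F-part = trans (reflexive (cong (δ R) (≡.trans (FCond-flat (α ⊙ (m' ∷ [])) u)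
        (cong₂ _∧_ (cong (size (flat u) ≡ᵇ_) (≡.trans (size-⊙ c' cs m') (cong (Nat._+ suc m') α≈η)))
                   (≡.trans (cong (_⊆ᵇ D) (≡.trans (toBools-⊙ c' cs m') (cong (_++ replicate (suc m') false) toBools-α)))
                            (⊆ᵇ-++-falses b (suc m') D))))))
        (δ-∧ _ _)

    sgn-size-countFalse : ∀ a η →
      sgn R (size (a ∷ η)) * sgn R (countFalse (reverse (toBools (a ∷ η)))) ≈ sgn R (length (a ∷ η))
    sgn-size-countFalse a η = begin
      sgn R (size (a ∷ η)) * sgn R (countFalse (reverse (toBools (a ∷ η))))
        ≡⟨ cong₂ (λ u v → sgn R u * sgn R v) (≡.sym (countFalse-toBools a η)) (countFalse-reverse (toBools (a ∷ η))) ⟩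
      sgn R (k Nat.+ length (a ∷ η)) * sgn R k
        ≈⟨ *-congʳ (sgn-+ k _) ⟩
      (sgn R k * sgn R (length (a ∷ η))) * sgn R k
        ≈⟨ *-comm _ _ ⟩
      sgn R k * (sgn R k * sgn R (length (a ∷ η)))
        ≈⟨ *-assoc _ _ _ ⟨
      (sgn R k * sgn R k) * sgn R (length (a ∷ η))
        ≈⟨ trans (*-congʳ (sgn-square k)) (*-identityˡ _) ⟩
      sgn R (length (a ∷ η))
        ∎
      where k = countFalse (toBools (a ∷ η))

    Σ-term-allBools : ∀ m' a η u →
      Σ R (allBools (length (toBools (a ∷ η)))) (term m' (a ∷ η) u ∘ fromBools) ≈
      sgn R (length (a ∷ η)) * δ R (within (suc m') (reverse (a ∷ η)) (flat u))
    Σ-term-allBools m' a η u = begin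
      Σ R (allBools k) (term m' (a ∷ η) u ∘ fromBools)
        ≈⟨ Σ-congᴬ (allBools-length k) (λ b lb → term-fromBools m' a η u b lb) ⟩
      Σ R (allBools k) (λ b → sgn R (size (a ∷ η)) * (δ R S * (weight (map möbiusᶜ c) b * δ R (b ⊆ᵇ D))))
        ≈⟨ *-Σ _ (allBools k) _ ⟨
      sgn R (size (a ∷ η)) * Σ R (allBools k) (λ b → δ R S * (weight (map möbiusᶜ c) b * δ R (b ⊆ᵇ D)))
        ≈⟨ *-congˡ (*-Σ _ (allBools k) _) ⟨
      sgn R (size (a ∷ η)) * (δ R S * Σ R (allBools k) (λ b → weight (map möbiusᶜ c) b * δ R (b ⊆ᵇ D)))
        ≈⟨ *-congˡ (δ-guard S inner) ⟩
      sgn R (size (a ∷ η)) * (δ R S * (sgn R (countFalse c) * δ R (D ⊆ᵇ c)))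
        ≈⟨ *-congˡ (x∙yz≈y∙xz _ _ _) ⟩
      sgn R (size (a ∷ η)) * (sgn R (countFalse c) * (δ R S * δ R (D ⊆ᵇ c)))
        ≈⟨ *-assoc _ _ _ ⟨
      (sgn R (size (a ∷ η)) * sgn R (countFalse c)) * (δ R S * δ R (D ⊆ᵇ c))
        ≈⟨ *-cong (sgn-size-countFalse a η) (sym (δ-∧ _ _)) ⟩
      sgn R (length (a ∷ η)) * δ R (S ∧ (D ⊆ᵇ c))
        ≡⟨ cong (λ z → sgn R (length (a ∷ η)) * δ R z)
             (≡.sym (cong₂ (λ s v → (size (flat u) ≡ᵇ s Nat.+ suc m') ∧ (D ⊆ᵇ v))
                           (size-reverse (a ∷ η)) (toBools-reverse (a ∷ η)))) ⟩
      sgn R (length (a ∷ η)) * δ R (within (suc m') (reverse (a ∷ η)) (flat u))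
        ∎
      where
      cη = toBools (a ∷ η)
      c  = reverse cη
      k  = length cη
      D  = toBools (flat u)
      S  = size (flat u) ≡ᵇ size (a ∷ η) Nat.+ suc m'
      length-c : length c ≡ k
      length-c = length-reverse cη
      inner : S ≡ true → Σ R (allBools k) (λ b → weight (map möbiusᶜ c) b * δ R (b ⊆ᵇ D)) ≈
                         sgn R (countFalse c) * δ R (D ⊆ᵇ c)
      inner h = begin
        Σ R (allBools k) (λ b → weight (map möbiusᶜ c) b * δ R (b ⊆ᵇ D))
          ≡⟨ cong (λ n → Σ R (allBools n) (λ b → weight (map möbiusᶜ c) b * δ R (b ⊆ᵇ D))) length-c ⟨
        Σ R (allBools (length c)) (λ b → weight (map möbiusᶜ c) b * δ R (b ⊆ᵇ D))
          ≈⟨ Σ-möbiusᶜ-⊆ᵇ c D (ℕₚ.≤-trans (ℕₚ.≤-reflexive length-c) (ℕₚ.≤-trans (ℕₚ.m≤m+n k (suc m'))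
               (ℕₚ.≤-reflexive (≡.sym (length-toBools (flat u) (≡.trans (≡ᵇ≡true⇒≡ h)
                 (cong (Nat._+ suc m') (≡.sym (suc-length-toBools a η))))))))) ⟩
        sgn R (countFalse c) * δ R (D ⊆ᵇ c)
          ∎

    term-size : ∀ m' η u n α → size α ≡ n → term m' η u α ≈ δ R (n ≡ᵇ size η) * term m' η u α
    term-size m' η u n α sα = begin
      sgn R (size α) * (pair (ω α) M * F)
        ≈⟨ *-congˡ (*-congʳ (pair-size (ω α) η)) ⟩
      sgn R (size α) * ((δ R (size (ω α) ≡ᵇ size η) * pair (ω α) M) * F)
        ≡⟨ cong (λ z → sgn R (size α) * ((δ R (z ≡ᵇ size η) * pair (ω α) M) * F)) (≡.trans (size-ω α) sα) ⟩
      sgn R (size α) * ((δ R (n ≡ᵇ size η) * pair (ω α) M) * F)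
        ≈⟨ *-congˡ (*-assoc _ _ _) ⟩
      sgn R (size α) * (δ R (n ≡ᵇ size η) * (pair (ω α) M * F))
        ≈⟨ x∙yz≈y∙xz _ _ _ ⟩
      δ R (n ≡ᵇ size η) * term m' η u α
        ∎
      where
      M = (1# , η) ∷ []
      F = FPS R (α ⊙ single (suc m')) u

    Σ-term-compsOf : ∀ m' η u → Σ R (compsOf (size η)) (term m' η u) ≈
      sgn R (length η) * δ R (within (suc m') (reverse η) (flat u))
    Σ-term-compsOf m' [] u = begin
      sgn R 0 * (pair [] ((1# , []) ∷ []) * FPS R (single (suc m')) u) + 0#
        ≈⟨ +-identityʳ _ ⟩
      sgn R 0 * (pair [] ((1# , []) ∷ []) * FPS R (single (suc m')) u)
        ≈⟨ *-congˡ (trans (*-congʳ (trans (pair-M[] []) (reflexive (cong (δ R) (==-refl []))))) (*-identityˡ _)) ⟩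
      sgn R 0 * FPS R (single (suc m')) u
        ≡⟨ cong (λ z → sgn R 0 * δ R z) (≡.trans (FCond-flat (m' ∷ []) u)
             (cong₂ _∧_ (cong (size (flat u) ≡ᵇ_) (cong suc (ℕₚ.+-identityʳ m')))
                        (≡.trans (⊆ᵇ-++-falses [] m' (toBools (flat u))) (≡.sym (⊆ᵇ-[]ʳ (toBools (flat u))))))) ⟩
      sgn R 0 * δ R (within (suc m') [] (flat u))
        ∎
    Σ-term-compsOf m' (a ∷ η) u = begin
      Σ R (compsOf (size (a ∷ η))) (term m' (a ∷ η) u)
        ≡⟨ cong (λ z → Σ R (compsOf z) (term m' (a ∷ η) u)) (≡.sym (suc-length-toBools a η)) ⟩
      Σ R (map fromBools (allBools (length (toBools (a ∷ η))))) (term m' (a ∷ η) u)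
        ≡⟨ Σ-map fromBools (allBools (length (toBools (a ∷ η)))) (term m' (a ∷ η) u) ⟩
      Σ R (allBools (length (toBools (a ∷ η)))) (term m' (a ∷ η) u ∘ fromBools)
        ≈⟨ Σ-term-allBools m' a η u ⟩
      sgn R (length (a ∷ η)) * δ R (within (suc m') (reverse (a ∷ η)) (flat u))
        ∎

    -- Only the compositions of size |η| contribute.
    Σ-term-compsBelow : ∀ N m' η u → size η < N →
      Σ R (compsBelow N) (term m' η u) ≈ sgn R (length η) * δ R (within (suc m') (reverse η) (flat u))
    Σ-term-compsBelow N m' η u η<N = begin
      Σ R (compsBelow N) (term m' η u)
        ≈⟨ Σ-concatMap compsOf (upTo N) _ ⟩
      Σ R (upTo N) (λ n → Σ R (compsOf n) (term m' η u))
        ≈⟨ Σ-cong (upTo N) (λ n → trans (Σ-congᴬ (compsOf-size n) (term-size m' η u n))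
                                       (sym (*-Σ _ (compsOf n) _))) ⟩
      Σ R (upTo N) (λ n → δ R (n ≡ᵇ size η) * Σ R (compsOf n) (term m' η u))
        ≈⟨ Σ-upTo-δ N (size η) _ ⟩
      δ R (size η <ᵇ N) * Σ R (compsOf (size η)) (term m' η u)
        ≈⟨ trans (*-congʳ (reflexive (cong (δ R) (<⇒<ᵇ≡true η<N)))) (*-identityˡ _) ⟩
      Σ R (compsOf (size η)) (term m' η u)
        ≈⟨ Σ-term-compsOf m' η u ⟩
      sgn R (length η) * δ R (within (suc m') (reverse η) (flat u))
        ∎

    ⟦Rperp⟧ : ∀ β f v → ⟦_⟧ R (Rperp R P β f) v ≈
      Σ R f (λ { (a , γ) → Σ R (upTo (suc (length γ))) (λ i → (a * pair β ((1# , take i γ) ∷ [])) * MPS R (drop i γ) v) })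
    ⟦Rperp⟧ β f v = trans (⟦⟧-concatMap _ f v) (Σ-cong f (λ { (a , γ) → reflexive (Σ-map _ (upTo (suc (length γ))) _) }))

    rhsTerm : ℕ → Comp → Carrier → Comp → ℕ → Mono → Carrier
    rhsTerm m' α a γ i p = sgn R (size α) *
      mulPS R (FPS R (α ⊙ single (suc m'))) (λ y → (a * pair (ω α) ((1# , take i γ) ∷ [])) * MPS R (drop i γ) y) p

    rhsTerm-factor : ∀ m' α a γ i p →
      rhsTerm m' α a γ i p ≈ a * mulPS R (λ x → term m' (take i γ) x α) (MPS R (drop i γ)) p
    rhsTerm-factor m' α a γ i p = begin
      sgn R (size α) * mulPS R F (λ y → (a * pr) * Mν y) p  ≈⟨ *-congˡ (mulPS-*ʳ (a * pr) F Mν p) ⟩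
      sgn R (size α) * ((a * pr) * mulPS R F Mν p)          ≈⟨ *-congˡ (*-assoc a pr _) ⟩
      sgn R (size α) * (a * (pr * mulPS R F Mν p))          ≈⟨ x∙yz≈y∙xz _ _ _ ⟩
      a * (sgn R (size α) * (pr * mulPS R F Mν p))          ≈⟨ *-congˡ (*-congˡ (mulPS-*ˡ pr F Mν p)) ⟨
      a * (sgn R (size α) * mulPS R (λ x → pr * F x) Mν p)  ≈⟨ *-congˡ (mulPS-*ˡ (sgn R (size α)) _ Mν p) ⟨
      a * mulPS R (λ x → term m' (take i γ) x α) Mν p       ∎
      where
      F  = FPS R (α ⊙ single (suc m'))
      pr = pair (ω α) ((1# , take i γ) ∷ [])
      Mν = MPS R (drop i γ)

    summand-⟦⟧ : ∀ m' f α p → summand R P (suc m') f α p ≈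
      Σ R f (λ { (a , γ) → Σ R (upTo (suc (length γ))) (λ i → rhsTerm m' α a γ i p) })
    summand-⟦⟧ m' f α p = begin
      sgn R (size α) * mulPS R F (⟦_⟧ R (Rperp R P (ω α) f)) p
        ≈⟨ *-congˡ (trans (mulPS-cong p (λ _ → ≈-refl) (⟦Rperp⟧ (ω α) f)) (mulPS-Σʳ f F _ p)) ⟩
      sgn R (size α) * Σ R f (λ { (a , γ) → mulPS R F (λ y → Σ R (upTo (suc (length γ))) (λ i →
                                   (a * pair (ω α) ((1# , take i γ) ∷ [])) * MPS R (drop i γ) y)) p })
        ≈⟨ *-congˡ (Σ-cong f (λ { (a , γ) → mulPS-Σʳ (upTo (suc (length γ))) F _ p })) ⟩
      sgn R (size α) * Σ R f (λ { (a , γ) → Σ R (upTo (suc (length γ))) (λ i → mulPS R F (λ y →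
                                   (a * pair (ω α) ((1# , take i γ) ∷ [])) * MPS R (drop i γ) y) p) })
        ≈⟨ trans (*-Σ _ f _) (Σ-cong f (λ { (a , γ) → *-Σ _ (upTo (suc (length γ))) _ })) ⟩
      Σ R f (λ { (a , γ) → Σ R (upTo (suc (length γ))) (λ i → rhsTerm m' α a γ i p) })
        ∎
      where F = FPS R (α ⊙ single (suc m'))

    -- Summing over α first collapses each (a , γ)-column to a (h_m ≺ M_γ).
    Σ-rhsTerm : ∀ m' N a γ → size γ < N → ∀ p →
      Σ R (compsBelow N) (λ α → Σ R (upTo (suc (length γ))) (λ i → rhsTerm m' α a γ i p)) ≈
      a * precPS R (hPS R (suc m')) (MPS R γ) p
    Σ-rhsTerm m' N a γ γ<N p = begin
      Σ R (compsBelow N) (λ α → Σ R is (λ i → rhsTerm m' α a γ i p))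
        ≈⟨ Σ-comm (compsBelow N) is _ ⟩
      Σ R is (λ i → Σ R (compsBelow N) (λ α → rhsTerm m' α a γ i p))
        ≈⟨ Σ-cong is (λ i → Σ-cong (compsBelow N) (λ α → rhsTerm-factor m' α a γ i p)) ⟩
      Σ R is (λ i → Σ R (compsBelow N) (λ α → a * mulPS R (λ x → term m' (take i γ) x α) (MPS R (drop i γ)) p))
        ≈⟨ Σ-cong is (λ i → trans (sym (*-Σ a (compsBelow N) _)) (*-congˡ (sym (mulPS-Σˡ (compsBelow N) _ _ p)))) ⟩
      Σ R is (λ i → a * mulPS R (λ x → Σ R (compsBelow N) (term m' (take i γ) x)) (MPS R (drop i γ)) p)
        ≈⟨ Σ-congᴬ (upTo-< (suc (length γ))) (λ i i≤ℓ → *-congˡ (mulPS-cong p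
             (λ x → trans (Σ-term-compsBelow N m' (take i γ) x (ℕₚ.≤-<-trans (size-take i γ) γ<N))
                          (reflexive (cong (λ z → sgn R z * withinPS (suc m') (reverse (take i γ)) x)
                                           (length-take-≤ i γ (ℕₚ.≤-pred i≤ℓ)))))
             (λ _ → ≈-refl))) ⟩
      Σ R is (λ i → a * mulPS R (λ x → sgn R i * withinPS (suc m') (reverse (take i γ)) x) (MPS R (drop i γ)) p)
        ≈⟨ Σ-cong is (λ i → *-congˡ (mulPS-*ˡ (sgn R i) _ _ p)) ⟩
      Σ R is (λ i → a * (sgn R i * splitTerm (suc m') γ i p))
        ≈⟨ *-Σ a is _ ⟨
      a * Σ R is (λ i → sgn R i * splitTerm (suc m') γ i p)
        ≈⟨ *-congˡ (precPS-h-M m' γ p) ⟨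
      a * precPS R (hPS R (suc m')) (MPS R γ) p
        ∎
      where is = upTo (suc (length γ))

    -- (R_ω(α), M_η) needs |α| = |η|, and every prefix η of a γ in f is shorter than α.
    summand-vanishes : ∀ m' f α → suc (maxSize f) ≤ size α → ∀ p → summand R P (suc m') f α p ≈ 0#
    summand-vanishes m' f α N≤α p = trans (*-congˡ (mulPS-zeroʳ _ _ p Rperp-vanishes)) (zeroʳ _)
      where
      pair-vanishes : ∀ a γ i → size γ < suc (maxSize f) → ∀ y →
        (a * pair (ω α) ((1# , take i γ) ∷ [])) * MPS R (drop i γ) y ≈ 0#
      pair-vanishes a γ i γ<N y = begin
        (a * pair (ω α) ((1# , take i γ) ∷ [])) * MPS R (drop i γ) y
          ≈⟨ *-congʳ (*-congˡ (pair-size (ω α) (take i γ))) ⟩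
        (a * (δ R (size (ω α) ≡ᵇ size (take i γ)) * pair (ω α) ((1# , take i γ) ∷ []))) * MPS R (drop i γ) y
          ≡⟨ cong (λ z → (a * (δ R z * pair (ω α) ((1# , take i γ) ∷ []))) * MPS R (drop i γ) y)
               (dec-false (size (ω α) ℕₚ.≟ size (take i γ)) (λ e → ℕₚ.<⇒≢ take<α (≡.sym (≡.trans (≡.sym (size-ω α)) e)))) ⟩
        (a * (0# * pair (ω α) ((1# , take i γ) ∷ []))) * MPS R (drop i γ) y
          ≈⟨ trans (*-congʳ (trans (*-congˡ (zeroˡ _)) (zeroʳ a))) (zeroˡ _) ⟩
        0#
          ∎
        where take<α = ℕₚ.≤-<-trans (size-take i γ) (ℕₚ.<-≤-trans γ<N N≤α)
      Rperp-vanishes : ∀ y → ⟦_⟧ R (Rperp R P (ω α) f) y ≈ 0#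
      Rperp-vanishes y = begin
        ⟦_⟧ R (Rperp R P (ω α) f) y
          ≈⟨ ⟦Rperp⟧ (ω α) f y ⟩
        Σ R f (λ { (a , γ) → Σ R (upTo (suc (length γ))) (λ i → (a * pair (ω α) ((1# , take i γ) ∷ [])) * MPS R (drop i γ) y) })
          ≈⟨ Σ-congᴬ (size<suc-maxSize f) (λ { (a , γ) γ<N → Σ-zero (upTo (suc (length γ))) (λ i → pair-vanishes a γ i γ<N y) }) ⟩
        Σ R f (λ _ → 0#)
          ≈⟨ Σ-zero f (λ _ → ≈-refl) ⟩
        0#
          ∎

    Σ-summand : ∀ m' f p →
      Σ R (compsBelow (suc (maxSize f))) (λ α → summand R P (suc m') f α p) ≈ precPS R (hPS R (suc m')) (⟦_⟧ R f) p
    Σ-summand m' f p = begin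
      Σ R (compsBelow N) (λ α → summand R P (suc m') f α p)
        ≈⟨ Σ-cong (compsBelow N) (λ α → summand-⟦⟧ m' f α p) ⟩
      Σ R (compsBelow N) (λ α → Σ R f (λ { (a , γ) → Σ R (upTo (suc (length γ))) (λ i → rhsTerm m' α a γ i p) }))
        ≈⟨ Σ-comm (compsBelow N) f _ ⟩
      Σ R f (λ { (a , γ) → Σ R (compsBelow N) (λ α → Σ R (upTo (suc (length γ))) (λ i → rhsTerm m' α a γ i p)) })
        ≈⟨ Σ-congᴬ (size<suc-maxSize f) (λ { (a , γ) γ<N → Σ-rhsTerm m' N a γ γ<N p }) ⟩
      Σ R f (λ { (a , γ) → a * precPS R (hPS R (suc m')) (MPS R γ) p })
        ≈⟨ precPS-⟦⟧ʳ (hPS R (suc m')) f p ⟨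
      precPS R (hPS R (suc m')) (⟦_⟧ R f) p
        ∎
      where N = suc (maxSize f)

theorem5p3 : ∀ {c ℓ : Level} (R : CommutativeRing c ℓ) (P : RibbonPairing R)
               (f : QS R) (m : ℕ) → 1 ≤ m →
               ∃[ N ] ((∀ α → N ≤ size α → ∀ p →
                         CommutativeRing._≈_ R (summand R P m f α p) (CommutativeRing.0# R))
                      × (∀ p → CommutativeRing._≈_ R (precPS R (hPS R m) (⟦_⟧ R f) p)
                                 (Σ R (compsBelow N) (λ α → summand R P m f α p))))
theorem5p3 R P f (suc m') _ =
  suc (maxSize R f) ,
  summand-vanishes R P m' f ,
  λ p → CommutativeRing.sym R (Σ-summand R P m' f p)
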